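{- Let $\Gamma$ be a finite cyclically orientable graph. Then one can attach signs $\pm1$ to all edges of $\Gamma$ so that the product of the signs along every chordless cycle of $\Gamma$ equals $-1$. Furthermore, such an attachment is unique up to the operations of simultaneously changing the signs of all edges incident to a given vertex.
   Context: Graphs are finite, simple, undirected. A chordless cycle in $\Gamma$ is an induced subgraph isomorphic to a cycle of length at least $3$. $\Gamma$ is cyclically orientable if it admits an orientation of its edges in which every chordless cycle is cyclically oriented (its edges form a directed cycle). -}

module Defs where

open import Data.Nat using (ℕ; suc; _+_)
open import Data.Nat.DivMod using (_mod_)
open import Data.Fin using (Fin; toℕ)
open import Data.Bool using (Bool; true; false; not; if_then_else_)
open import Data.Sign using (Sign) renaming (+ to pos; - to neg; _*_ to _·_)
open import Data.List using (foldr; map; allFin)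
open import Data.Product using (Σ; _×_; ∃)
open import Data.Sum using (_⊎_)
open import Relation.Binary.PropositionalEquality using (_≡_)
open import Function.Definitions using (Injective)

record Graph (n : ℕ) : Set where
  field
    adj   : Fin n → Fin n → Bool
    sym   : ∀ u v → adj u v ≡ adj v u
    irref : ∀ v → adj v v ≡ false
open Graph public

next : ∀ {m} → Fin (suc m) → Fin (suc m)
next {m} i = suc (toℕ i) mod (suc m)

-- A chordless cycle of length k = 3 + m: an injective map c from the
-- vertices of the cycle C_k into Γ such that c i, c j are adjacent in Γ
-- iff i, j are adjacent in C_k (i.e. an induced subgraph ≅ C_k).
record ChordlessCycle {n} (Γ : Graph n) (m : ℕ) : Set where
  field
    c       : Fin (3 + m) → Fin n
    inj     : Injective _≡_ _≡_ c
    edges   : ∀ i j → (j ≡ next i ⊎ i ≡ next j) → adj Γ (c i) (c j) ≡ true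
    chords  : ∀ i j → adj Γ (c i) (c j) ≡ true → (j ≡ next i ⊎ i ≡ next j)
open ChordlessCycle public

-- An orientation: dir u v ≡ true means the edge {u,v} is directed u → v.
-- Each edge gets exactly one direction.
Orientation : ∀ {n} → Graph n → Set
Orientation {n} Γ =
  Σ (Fin n → Fin n → Bool) λ dir →
    ∀ u v → adj Γ u v ≡ true → dir v u ≡ not (dir u v)

CyclicallyOriented : ∀ {n} {Γ : Graph n} {m} →
  (Fin n → Fin n → Bool) → ChordlessCycle Γ m → Set
CyclicallyOriented dir C =
  (∀ i → dir (c C i) (c C (next i)) ≡ true) ⊎
  (∀ i → dir (c C (next i)) (c C i) ≡ true)

CyclicallyOrientable : ∀ {n} → Graph n → Set
CyclicallyOrientable Γ =
  Σ (Orientation Γ) λ o →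
    ∀ m (C : ChordlessCycle Γ m) → CyclicallyOriented (Data.Product.proj₁ o) C

-- A signing: a sign on each edge; given as a function on ordered pairs
-- which is required to be symmetric on edges (values on non-edges are irrelevant).
Signing : ∀ {n} → Graph n → Set
Signing {n} Γ =
  Σ (Fin n → Fin n → Sign) λ s →
    ∀ u v → adj Γ u v ≡ true → s u v ≡ s v u

cycleProduct : ∀ {n} {Γ : Graph n} {m} →
  (Fin n → Fin n → Sign) → ChordlessCycle Γ m → Sign
cycleProduct s C =
  foldr _·_ pos (map (λ i → s (c C i) (c C (next i))) (allFin _))

AllChordlessNegative : ∀ {n} (Γ : Graph n) → (Fin n → Fin n → Sign) → Set
AllChordlessNegative Γ s = ∀ m (C : ChordlessCycle Γ m) → cycleProduct s C ≡ neg

-- Switching at a set X of vertices (X v ≡ true): every edge incident to a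
-- vertex of X changes sign, once per endpoint in X.  This is exactly the
-- result of any finite sequence of single-vertex switching operations.
flipSign : Bool → Sign
flipSign b = if b then neg else pos

switch : ∀ {n} → (Fin n → Bool) → (Fin n → Fin n → Sign) → Fin n → Fin n → Sign
switch X s u v = s u v · flipSign (X u) · flipSign (X v)

SwitchingEquivalent : ∀ {n} (Γ : Graph n) → (s t : Fin n → Fin n → Sign) → Set
SwitchingEquivalent {n} Γ s t =
  ∃ λ (X : Fin n → Bool) → ∀ u v → adj Γ u v ≡ true → t u v ≡ switch X s u v

{-# OPTIONS --safe #-}
module Submission where

-- If s and t are both negative on every chordless cycle, then s·t is positive on every
-- chordless cycle. Every closed walk splits, at a repeated vertex, at a chord, or at a second neighbour
-- of its base point, into two shorter closed walks, down to chordless cycles and back-and-forth steps;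
-- so s·t is positive on all closed walks, hence of the form u v ↦ X u · X v, and switching s at the
-- vertices with X = − gives t.
--
-- Existence, by induction on the number of vertices. A good signing of Γ − 0 is extended by signs σ x
-- on the edges 0 x, which must satisfy σ x · σ y = − (sign of the path x … y) for every chordless cycle
-- 0, x, …, y, 0. In a cyclic orientation such a cycle is determined by x and y, so these constraints form
-- a signed graph H on the neighbours of 0. H has no chordless cycle: one would yield a walk between two
-- out-neighbours of a vertex c avoiding the other neighbours of c, and an induced path inside it closes
-- up through c to a chordless cycle that is not cyclically oriented. Hence H is balanced and σ exists.

open import Defs renaming (sym to adj-sym)

open import Data.Bool using (Bool; true; false; not; _∨_)
import Data.Bool.Properties as Bool
open import Data.Empty using (⊥; ⊥-elim)
open import Data.Fin using (Fin; zero; suc; toℕ; fromℕ; inject₁)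
import Data.Fin.Properties as Fin
open import Data.List using (List; []; _∷_; _++_; [_]; length; reverse; tabulate; lookup; map; allFin; foldr; cartesianProductWith)
import Data.List.Properties as List
open import Data.List.Membership.Propositional using (_∈_; _∉_; find)
import Data.List.Membership.DecPropositional as DecMembership
open import Data.List.Membership.Propositional.Properties using (∈-lookup; ∈-∃++; ∈-allFin; ∈-cartesianProductWith⁺)
open import Data.List.Relation.Binary.Permutation.Setoid using (↭-sym)
open import Data.List.Relation.Binary.Permutation.Setoid.Properties using (Unique-resp-↭; ↭-reverse)
open import Data.List.Relation.Unary.All as All using (All; []; _∷_)
import Data.List.Relation.Unary.All.Properties as All
open import Data.List.Relation.Unary.AllPairs using ([]; _∷_)
open import Data.List.Relation.Unary.Any as Any using (Any; here; there)
import Data.List.Relation.Unary.Any.Properties as Any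
open import Data.List.Relation.Unary.Unique.Propositional using (Unique)
open import Data.List.Relation.Unary.Unique.Propositional.Properties as Unique using (Unique[x∷xs]⇒x∉xs)
import Data.List.Relation.Unary.Unique.DecPropositional as UniqueDec
open import Data.Nat using (ℕ; zero; suc; _+_; _≤_; _<_; z≤n; s≤s)
open import Data.Nat.DivMod using (_%_; m<n⇒m%n≡m; n%n≡0)
import Data.Nat.Properties as ℕ
open import Data.Nat.Tactic.RingSolver using (solve-∀)
open import Data.Product using (Σ; ∃; _×_; _,_; proj₁; proj₂; uncurry)
import Data.Product
open import Data.Sign using (Sign) renaming (+ to pos; - to neg; _*_ to _·_)
open import Data.Sign.Properties using (*-comm; *-assoc; *-identityʳ; s*s≡+; *-commutativeSemigroup; *-commutativeMonoid)
open import Data.Sum using (_⊎_; inj₁; inj₂) renaming ([_,_] to either)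
import Data.Sum
open import Function using (_∘_; id; case_of_)
open import Relation.Binary.Definitions using (DecidableEquality; tri<; tri≈; tri>)
open import Relation.Binary.PropositionalEquality hiding ([_])
open import Relation.Nullary using (¬_; Dec; yes; no; ¬?)
open import Relation.Nullary.Decidable using (_×-dec_; map′; does; dec-true)

open import Algebra.Properties.CommutativeSemigroup *-commutativeSemigroup using (interchange)
open import Algebra.Solver.CommutativeMonoid *-commutativeMonoid using (solve; _⊜_; _⊕_) renaming (id to ε)

true≢false : true ≢ false
true≢false ()

∏ : List Sign → Sign
∏ = foldr _·_ pos

·≡pos⇒≡ : ∀ {a b} → a · b ≡ pos → a ≡ b
·≡pos⇒≡ {pos} {pos} _ = refl
·≡pos⇒≡ {neg} {neg} _ = refl

∏-tabulate-snoc : ∀ {m} (f : Fin (suc m) → Sign) → ∏ (tabulate f) ≡ ∏ (tabulate (f ∘ inject₁)) · f (fromℕ m)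
∏-tabulate-snoc {zero} f = *-identityʳ (f zero)
∏-tabulate-snoc {suc m} f = trans (cong (f zero ·_) (∏-tabulate-snoc (f ∘ suc))) (sym (*-assoc (f zero) _ _))

toℕ-next : ∀ {m} (i : Fin (suc m)) → toℕ (next i) ≡ suc (toℕ i) % suc m
toℕ-next i = Fin.toℕ-fromℕ< _

next-inject₁ : ∀ {m} (j : Fin m) → next (inject₁ j) ≡ suc j
next-inject₁ {m} j = Fin.toℕ-injective (begin
  toℕ (next (inject₁ j))       ≡⟨ toℕ-next (inject₁ j) ⟩
  suc (toℕ (inject₁ j)) % suc m ≡⟨ cong (λ k → suc k % suc m) (Fin.toℕ-inject₁ j) ⟩
  suc (toℕ j) % suc m           ≡⟨ m<n⇒m%n≡m (s≤s (Fin.toℕ<n j)) ⟩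
  suc (toℕ j)                   ∎)
  where open ≡-Reasoning

next-fromℕ : ∀ m → next (fromℕ m) ≡ zero
next-fromℕ m = Fin.toℕ-injective (begin
  toℕ (next (fromℕ m))         ≡⟨ toℕ-next (fromℕ m) ⟩
  suc (toℕ (fromℕ m)) % suc m  ≡⟨ cong (λ k → suc k % suc m) (Fin.toℕ-fromℕ m) ⟩
  suc m % suc m                ≡⟨ n%n≡0 (suc m) ⟩
  0                            ∎)
  where open ≡-Reasoning

next-zero : ∀ {m} → next {suc m} zero ≡ suc zero
next-zero = next-inject₁ zero

fromℕ-or-inject₁ : ∀ {m} (i : Fin (suc m)) → i ≡ fromℕ m ⊎ ∃ λ j → i ≡ inject₁ j
fromℕ-or-inject₁ {zero} zero = inj₁ refl
fromℕ-or-inject₁ {suc m} zero = inj₂ (zero , refl)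
fromℕ-or-inject₁ {suc m} (suc i) with fromℕ-or-inject₁ i
... | inj₁ e = inj₁ (cong suc e)
... | inj₂ (j , e) = inj₂ (suc j , cong suc e)

next-injective : ∀ {m} {i j : Fin (suc m)} → next i ≡ next j → i ≡ j
next-injective {m} {i} {j} e with fromℕ-or-inject₁ i | fromℕ-or-inject₁ j
... | inj₁ refl | inj₁ refl = refl
... | inj₁ refl | inj₂ (b , refl) with trans (sym (next-fromℕ m)) (trans e (next-inject₁ b))
... | ()
next-injective {m} e | inj₂ (a , refl) | inj₁ refl with trans (sym (next-fromℕ m)) (trans (sym e) (next-inject₁ a))
... | ()
next-injective e | inj₂ (a , refl) | inj₂ (b , refl) =
  cong inject₁ (Fin.suc-injective (trans (sym (next-inject₁ a)) (trans e (next-inject₁ b))))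

next≡zero⇒≡fromℕ : ∀ {m} {i : Fin (suc m)} → next i ≡ zero → i ≡ fromℕ m
next≡zero⇒≡fromℕ {m} {i} e with fromℕ-or-inject₁ i
... | inj₁ p = p
... | inj₂ (a , refl) with trans (sym (next-inject₁ a)) e
... | ()

toℕ-next-cases : ∀ {m} (i : Fin (suc m)) → toℕ (next i) ≡ 0 ⊎ toℕ (next i) ≡ suc (toℕ i)
toℕ-next-cases {m} i with fromℕ-or-inject₁ i
... | inj₁ refl = inj₁ (cong toℕ (next-fromℕ m))
... | inj₂ (j , refl) = inj₂ (trans (cong toℕ (next-inject₁ j)) (cong suc (sym (Fin.toℕ-inject₁ j))))

toℕ≡suc⇒≡next : ∀ {m} (i j : Fin (suc m)) → toℕ j ≡ suc (toℕ i) → j ≡ next i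
toℕ≡suc⇒≡next {m} i j e with fromℕ-or-inject₁ i
... | inj₁ refl = ⊥-elim (ℕ.<-irrefl (trans e (cong suc (Fin.toℕ-fromℕ m))) (Fin.toℕ<n j))
... | inj₂ (k , refl) = Fin.toℕ-injective (trans e (trans (cong suc (Fin.toℕ-inject₁ k)) (sym (cong toℕ (next-inject₁ k)))))

far-apart⇒not-consecutive : ∀ {m} (i j : Fin (suc m)) → suc (suc (toℕ i)) ≤ toℕ j →
  ¬ (suc j ≡ next (suc i) ⊎ suc i ≡ next (suc j))
far-apart⇒not-consecutive i j le (inj₁ p) with toℕ-next-cases (suc i)
... | inj₁ z with trans (sym z) (cong toℕ (sym p))
...   | ()
far-apart⇒not-consecutive i j le (inj₁ p) | inj₂ q =
  ℕ.<-irrefl refl (ℕ.≤-trans le (ℕ.≤-reflexive (ℕ.suc-injective (trans (cong toℕ p) q))))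
far-apart⇒not-consecutive i j le (inj₂ p) with toℕ-next-cases (suc j)
... | inj₁ z with trans (sym z) (cong toℕ (sym p))
...   | ()
far-apart⇒not-consecutive i j le (inj₂ p) | inj₂ q =
  ℕ.<-asym (ℕ.≤-reflexive (sym (ℕ.suc-injective (trans (cong toℕ p) q)))) (ℕ.≤-trans (ℕ.n≤1+n (suc (toℕ i))) le)

rotate : ∀ {m} → ℕ → Fin (suc m) → Fin (suc m)
rotate zero i = i
rotate (suc k) i = next (rotate k i)

rotate-next : ∀ {m} k (i : Fin (suc m)) → rotate k (next i) ≡ next (rotate k i)
rotate-next zero i = refl
rotate-next (suc k) i = cong next (rotate-next k i)

rotate-injective : ∀ {m} k {i j : Fin (suc m)} → rotate k i ≡ rotate k j → i ≡ j
rotate-injective zero e = e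
rotate-injective (suc k) e = rotate-injective k (next-injective e)

rotate-toℕ-zero : ∀ {m} (p : Fin (suc m)) → rotate (toℕ p) zero ≡ p
rotate-toℕ-zero p = go (toℕ p) p refl
  where
  go : ∀ {m} k (p : Fin (suc m)) → toℕ p ≡ k → rotate k zero ≡ p
  go zero zero e = refl
  go {suc m} (suc k) (suc p) e =
    trans (cong next (go k (inject₁ p) (trans (Fin.toℕ-inject₁ p) (ℕ.suc-injective e)))) (next-inject₁ p)

∏-tabulate-next : ∀ {m} (f : Fin (suc m) → Sign) → ∏ (tabulate (f ∘ next)) ≡ ∏ (tabulate f)
∏-tabulate-next {m} f = begin
  ∏ (tabulate (f ∘ next))                                 ≡⟨ ∏-tabulate-snoc (f ∘ next) ⟩
  ∏ (tabulate (f ∘ next ∘ inject₁)) · f (next (fromℕ m))  ≡⟨ cong₂ _·_ (cong ∏ (List.tabulate-cong (cong f ∘ next-inject₁)))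
                                                                       (cong f (next-fromℕ m)) ⟩
  ∏ (tabulate (f ∘ suc)) · f zero                         ≡⟨ *-comm _ (f zero) ⟩
  ∏ (tabulate f)                                          ∎
  where open ≡-Reasoning

∏-tabulate-rotate : ∀ {m} (f : Fin (suc m) → Sign) k → ∏ (tabulate (f ∘ rotate k)) ≡ ∏ (tabulate f)
∏-tabulate-rotate f zero = refl
∏-tabulate-rotate f (suc k) = begin
  ∏ (tabulate (f ∘ next ∘ rotate k)) ≡⟨ cong ∏ (List.tabulate-cong (cong f ∘ sym ∘ rotate-next k)) ⟩
  ∏ (tabulate (f ∘ rotate k ∘ next)) ≡⟨ ∏-tabulate-next (f ∘ rotate k) ⟩
  ∏ (tabulate (f ∘ rotate k))        ≡⟨ ∏-tabulate-rotate f k ⟩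
  ∏ (tabulate f)                     ∎
  where open ≡-Reasoning

module _ {A : Set} where

  end : A → List A → A
  end x [] = x
  end x (y ∷ ys) = end y ys

  end-++ : ∀ x xs ys → end x (xs ++ ys) ≡ end (end x xs) ys
  end-++ x [] ys = refl
  end-++ x (y ∷ xs) ys = end-++ y xs ys

  end-∈ : ∀ x xs → end x xs ∈ x ∷ xs
  end-∈ x [] = here refl
  end-∈ x (y ∷ ys) = there (end-∈ y ys)

  lookup-fromℕ-length : ∀ x xs → lookup (x ∷ xs) (fromℕ (length xs)) ≡ end x xs
  lookup-fromℕ-length x [] = refl
  lookup-fromℕ-length x (y ∷ ys) = lookup-fromℕ-length y ys

  end-tabulate : ∀ {m} (g : Fin (suc m) → A) → end (g zero) (tabulate (g ∘ suc)) ≡ g (fromℕ m)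
  end-tabulate {zero} g = refl
  end-tabulate {suc m} g = end-tabulate (g ∘ suc)

  front : A → List A → List A
  front x [] = []
  front x (y ∷ ys) = x ∷ front y ys

  front-end : ∀ x xs → x ∷ xs ≡ front x xs ++ [ end x xs ]
  front-end x [] = refl
  front-end x (y ∷ ys) = cong (x ∷_) (front-end y ys)

  front-snoc : ∀ x xs ys y → x ∷ xs ≡ ys ++ [ y ] → front x xs ≡ ys
  front-snoc x [] [] y e = refl
  front-snoc x [] (_ ∷ []) y ()
  front-snoc x [] (_ ∷ _ ∷ _) y ()
  front-snoc x (z ∷ zs) [] y ()
  front-snoc x (z ∷ zs) (w ∷ ws) y e with List.∷-injective e
  ... | refl , e′ = cong (x ∷_) (front-snoc z zs ws y e′)

  reverseTail : A → List A → List A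
  reverseTail x [] = []
  reverseTail x (y ∷ ys) = reverseTail y ys ++ [ x ]

  reverse-∷ : ∀ x xs → reverse (x ∷ xs) ≡ end x xs ∷ reverseTail x xs
  reverse-∷ x [] = refl
  reverse-∷ x (y ∷ ys) = trans (List.unfold-reverse x (y ∷ ys)) (cong (_++ [ x ]) (reverse-∷ y ys))

  end-reverseTail : ∀ x xs → end (end x xs) (reverseTail x xs) ≡ x
  end-reverseTail x [] = refl
  end-reverseTail x (y ∷ ys) = end-++ (end y ys) (reverseTail y ys) [ x ]

  front-reverseTail : ∀ x xs → front (end x xs) (reverseTail x xs) ≡ reverse xs
  front-reverseTail x xs =
    front-snoc _ _ (reverse xs) x (trans (sym (reverse-∷ x xs)) (List.unfold-reverse x xs))

  length-reverseTail : ∀ x xs → length (reverseTail x xs) ≡ length xs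
  length-reverseTail x xs = ℕ.suc-injective (begin
    suc (length (reverseTail x xs))   ≡⟨ cong length (reverse-∷ x xs) ⟨
    length (reverse (x ∷ xs))         ≡⟨ List.length-reverse (x ∷ xs) ⟩
    suc (length xs)                   ∎)
    where open ≡-Reasoning

  ∈-reversed⁺ : ∀ {z} x xs → z ∈ x ∷ xs → z ∈ end x xs ∷ reverseTail x xs
  ∈-reversed⁺ x xs m = subst (_ ∈_) (reverse-∷ x xs) (Any.reverse⁺ m)

  ∈-reversed⁻ : ∀ {z} x xs → z ∈ end x xs ∷ reverseTail x xs → z ∈ x ∷ xs
  ∈-reversed⁻ x xs m = Any.reverse⁻ (subst (_ ∈_) (sym (reverse-∷ x xs)) m)

module _ {A : Set} where

  Unique-reversed : ∀ (x : A) xs → Unique (x ∷ xs) → Unique (end x xs ∷ reverseTail x xs)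
  Unique-reversed x xs u =
    subst Unique (reverse-∷ x xs) (Unique-resp-↭ (setoid A) (↭-sym (setoid A) (↭-reverse (setoid A) (x ∷ xs))) u)

  Unique-lookup-injective : ∀ (xs : List A) → Unique xs → ∀ {i j} → lookup xs i ≡ lookup xs j → i ≡ j
  Unique-lookup-injective (x ∷ xs) u {zero} {zero} e = refl
  Unique-lookup-injective (x ∷ xs) u {zero} {suc j} e = ⊥-elim (Unique[x∷xs]⇒x∉xs u (subst (_∈ xs) (sym e) (∈-lookup j)))
  Unique-lookup-injective (x ∷ xs) u {suc i} {zero} e = ⊥-elim (Unique[x∷xs]⇒x∉xs u (subst (_∈ xs) e (∈-lookup i)))
  Unique-lookup-injective (x ∷ xs) (_ ∷ u) {suc i} {suc j} e = cong suc (Unique-lookup-injective xs u e)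

  Unique-++⁻ : ∀ (xs ys : List A) → Unique (xs ++ ys) → Unique xs × (∀ {z} → z ∈ xs → z ∉ ys)
  Unique-++⁻ [] ys u = [] , λ ()
  Unique-++⁻ (x ∷ xs) ys (x≢ ∷ u) with Unique-++⁻ xs ys u
  ... | uxs , disj = All.++⁻ˡ xs x≢ ∷ uxs , λ
    { (here refl) m → All.lookup (All.++⁻ʳ xs x≢) m refl
    ; (there m₁) m₂ → disj m₁ m₂ }

  head≢end : ∀ (x : A) xs → Unique (x ∷ xs) → xs ≢ [] → x ≢ end x xs
  head≢end x [] u ne e = ne refl
  head≢end x (y ∷ ys) u ne e = Unique[x∷xs]⇒x∉xs u (subst (_∈ y ∷ ys) (sym e) (end-∈ y ys))

walkSign : ∀ {A : Set} → (A → A → Sign) → A → List A → Sign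
walkSign s x [] = pos
walkSign s x (y ∷ ys) = s x y · walkSign s y ys

walkSign-++ : ∀ {A : Set} (s : A → A → Sign) x xs ys →
  walkSign s x (xs ++ ys) ≡ walkSign s x xs · walkSign s (end x xs) ys
walkSign-++ s x [] ys = refl
walkSign-++ s x (y ∷ xs) ys = trans (cong (s x y ·_) (walkSign-++ s y xs ys)) (sym (*-assoc (s x y) _ _))

walkSign-· : ∀ {A : Set} (s t : A → A → Sign) x xs →
  walkSign (λ u v → s u v · t u v) x xs ≡ walkSign s x xs · walkSign t x xs
walkSign-· s t x [] = refl
walkSign-· s t x (y ∷ ys) = trans (cong (s x y · t x y ·_) (walkSign-· s t y ys)) (interchange (s x y) (t x y) _ _)

module Walks {V : Set} (R : V → V → Bool) where

  data Walk : V → List V → Set where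
    []ʷ : ∀ {x} → Walk x []
    _∷ʷ_ : ∀ {x y ys} → R x y ≡ true → Walk y ys → Walk x (y ∷ ys)

  data Chordless : V → List V → Set where
    []ᶜ : ∀ {x} → Chordless x []
    _∷ᶜ_ : ∀ {x y ys} → All (λ z → R x z ≡ false) ys → Chordless y ys → Chordless x (y ∷ ys)

  Walk-++ : ∀ {x} xs ys → Walk x xs → Walk (end x xs) ys → Walk x (xs ++ ys)
  Walk-++ [] ys w₁ w₂ = w₂
  Walk-++ (y ∷ xs) ys (e ∷ʷ w₁) w₂ = e ∷ʷ Walk-++ xs ys w₁ w₂

  Walk-++⁻ : ∀ {x} xs ys → Walk x (xs ++ ys) → Walk x xs × Walk (end x xs) ys
  Walk-++⁻ [] ys w = []ʷ , w
  Walk-++⁻ (y ∷ xs) ys (e ∷ʷ w) with Walk-++⁻ xs ys w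
  ... | w₁ , w₂ = e ∷ʷ w₁ , w₂

  Walk-split : ∀ {x} xs {y} ys → Walk x (xs ++ y ∷ ys) → Walk x xs × R (end x xs) y ≡ true × Walk y ys
  Walk-split xs ys w with Walk-++⁻ xs (_ ∷ ys) w
  ... | w₁ , (e ∷ʷ w₂) = w₁ , e , w₂

  Walk-snoc : ∀ {x} xs {y} → Walk x xs → R (end x xs) y ≡ true → Walk x (xs ++ [ y ])
  Walk-snoc xs w e = Walk-++ xs _ w (e ∷ʷ []ʷ)

  Chordless-snoc : ∀ {x} xs {y} → Chordless x xs → All (λ z → R z y ≡ false) (front x xs) →
    Chordless x (xs ++ [ y ])
  Chordless-snoc [] []ᶜ _ = [] ∷ᶜ []ᶜ
  Chordless-snoc (z ∷ zs) (nz ∷ᶜ c) (p ∷ ps) = All.++⁺ nz (p ∷ []) ∷ᶜ Chordless-snoc zs c ps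

  walk? : ∀ x xs → Dec (Walk x xs)
  walk? x [] = yes []ʷ
  walk? x (y ∷ ys) = map′ (uncurry _∷ʷ_) (λ { (e ∷ʷ w) → e , w }) (R x y Bool.≟ true ×-dec walk? y ys)

  chordless? : ∀ x xs → Dec (Chordless x xs)
  chordless? x [] = yes []ᶜ
  chordless? x (y ∷ ys) = map′ (uncurry _∷ᶜ_) (λ { (n ∷ᶜ c) → n , c })
    (All.all? (λ z → R x z Bool.≟ false) ys ×-dec chordless? y ys)

  module Symmetric (R-sym : ∀ x y → R x y ≡ R y x) where

    Walk-reversed : ∀ x xs → Walk x xs → Walk (end x xs) (reverseTail x xs)
    Walk-reversed x [] w = []ʷ
    Walk-reversed x (y ∷ ys) (e ∷ʷ w) = Walk-snoc (reverseTail y ys) (Walk-reversed y ys w)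
      (trans (cong (λ u → R u x) (end-reverseTail y ys)) (trans (R-sym y x) e))

    Chordless-reversed : ∀ x xs → Chordless x xs → Chordless (end x xs) (reverseTail x xs)
    Chordless-reversed x [] c = []ᶜ
    Chordless-reversed x (y ∷ ys) (nx ∷ᶜ c) = Chordless-snoc (reverseTail y ys) (Chordless-reversed y ys c)
      (subst (All (λ w → R w x ≡ false)) (sym (front-reverseTail y ys))
        (All.tabulate (λ m → trans (R-sym _ x) (All.lookup nx (Any.reverse⁻ m)))))

    walkSign-reversed : ∀ (s : V → V → Sign) → (∀ u v → R u v ≡ true → s u v ≡ s v u) →
      ∀ x xs → Walk x xs → walkSign s x xs ≡ walkSign s (end x xs) (reverseTail x xs)
    walkSign-reversed s s-sym x [] w = refl
    walkSign-reversed s s-sym x (y ∷ ys) (e ∷ʷ w) = begin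
      s x y · walkSign s y ys                                            ≡⟨ *-comm (s x y) _ ⟩
      walkSign s y ys · s x y                                            ≡⟨ cong₂ _·_ (walkSign-reversed s s-sym y ys w) (s-sym x y e) ⟩
      W · s y x                                                          ≡⟨ cong (λ u → W · s u x) (end-reverseTail y ys) ⟨
      W · s (end (end y ys) (reverseTail y ys)) x                        ≡⟨ cong (W ·_) (*-identityʳ _) ⟨
      W · walkSign s (end (end y ys) (reverseTail y ys)) [ x ]           ≡⟨ walkSign-++ s _ (reverseTail y ys) [ x ] ⟨
      walkSign s (end y ys) (reverseTail y ys ++ [ x ])                  ∎
      where
      open ≡-Reasoning
      W : Sign
      W = walkSign s (end y ys) (reverseTail y ys)

  Walk-lookup⁻ : ∀ x xs → Walk x xs → ∀ (j : Fin (length xs)) → R (lookup (x ∷ xs) (inject₁ j)) (lookup (x ∷ xs) (suc j)) ≡ true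
  Walk-lookup⁻ x (y ∷ ys) (e ∷ʷ w) zero = e
  Walk-lookup⁻ x (y ∷ ys) (e ∷ʷ w) (suc j) = Walk-lookup⁻ y ys w j

  Walk-lookup⁺ : ∀ x xs → (∀ (j : Fin (length xs)) → R (lookup (x ∷ xs) (inject₁ j)) (lookup (x ∷ xs) (suc j)) ≡ true) → Walk x xs
  Walk-lookup⁺ x [] h = []ʷ
  Walk-lookup⁺ x (y ∷ ys) h = h zero ∷ʷ Walk-lookup⁺ y ys (h ∘ suc)

  Chordless-lookup⁻ : ∀ x xs → Chordless x xs → ∀ (i j : Fin (length (x ∷ xs))) → suc (suc (toℕ i)) ≤ toℕ j →
    R (lookup (x ∷ xs) i) (lookup (x ∷ xs) j) ≡ false
  Chordless-lookup⁻ x (y ∷ ys) (nx ∷ᶜ c) zero (suc (suc k)) le = All.lookup nx (∈-lookup k)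
  Chordless-lookup⁻ x (y ∷ ys) (nx ∷ᶜ c) (suc i) (suc j) (s≤s le) = Chordless-lookup⁻ y ys c i j le
  Chordless-lookup⁻ x (y ∷ ys) c zero (suc zero) (s≤s ())
  Chordless-lookup⁻ x [] c zero zero ()

  Walk-tabulate⁺ : ∀ {m} (g : Fin (suc m) → V) → (∀ (j : Fin m) → R (g (inject₁ j)) (g (suc j)) ≡ true) →
    Walk (g zero) (tabulate (g ∘ suc))
  Walk-tabulate⁺ {zero} g h = []ʷ
  Walk-tabulate⁺ {suc m} g h = h zero ∷ʷ Walk-tabulate⁺ (g ∘ suc) (h ∘ suc)

  Chordless-tabulate⁺ : ∀ {m} (g : Fin (suc m) → V) →
    (∀ (i j : Fin (suc m)) → suc (suc (toℕ i)) ≤ toℕ j → R (g i) (g j) ≡ false) → Chordless (g zero) (tabulate (g ∘ suc))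
  Chordless-tabulate⁺ {zero} g h = []ᶜ
  Chordless-tabulate⁺ {suc m} g h = All.tabulate⁺ (λ k → h zero (suc (suc k)) (s≤s (s≤s z≤n)))
    ∷ᶜ Chordless-tabulate⁺ (g ∘ suc) (λ i j le → h (suc i) (suc j) (s≤s le))

module _ {A : Set} (s : A → A → Sign) where

  walkSign-tabulate : ∀ {m} (g : Fin (suc m) → A) →
    walkSign s (g zero) (tabulate (g ∘ suc)) ≡ ∏ (tabulate (λ j → s (g (inject₁ j)) (g (suc j))))
  walkSign-tabulate {zero} g = refl
  walkSign-tabulate {suc m} g = cong (s (g zero) (g (suc zero)) ·_) (walkSign-tabulate (g ∘ suc))

  ∏-cyclic≡walkSign : ∀ {m} (g : Fin (suc m) → A) →
    ∏ (tabulate (λ i → s (g i) (g (next i)))) ≡ walkSign s (g zero) (tabulate (g ∘ suc) ++ [ g zero ])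
  ∏-cyclic≡walkSign {m} g = begin
    ∏ (tabulate (λ i → s (g i) (g (next i))))
      ≡⟨ ∏-tabulate-snoc (λ i → s (g i) (g (next i))) ⟩
    ∏ (tabulate (λ j → s (g (inject₁ j)) (g (next (inject₁ j))))) · s (g (fromℕ m)) (g (next (fromℕ m)))
      ≡⟨ cong₂ _·_ (cong ∏ (List.tabulate-cong (λ j → cong (s (g (inject₁ j)) ∘ g) (next-inject₁ j))))
                   (cong (s (g (fromℕ m)) ∘ g) (next-fromℕ m)) ⟩
    ∏ (tabulate (λ j → s (g (inject₁ j)) (g (suc j)))) · s (g (fromℕ m)) (g zero)
      ≡⟨ cong₂ _·_ (walkSign-tabulate g) (cong (λ u → s u (g zero)) (end-tabulate g)) ⟨
    W · s (end (g zero) (tabulate (g ∘ suc))) (g zero)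
      ≡⟨ cong (W ·_) (*-identityʳ _) ⟨
    W · walkSign s (end (g zero) (tabulate (g ∘ suc))) [ g zero ]
      ≡⟨ walkSign-++ s (g zero) (tabulate (g ∘ suc)) [ g zero ] ⟨
    walkSign s (g zero) (tabulate (g ∘ suc) ++ [ g zero ]) ∎
    where
    open ≡-Reasoning
    W : Sign
    W = walkSign s (g zero) (tabulate (g ∘ suc))

module OnGraph {n : ℕ} (Γ : Graph n) where

  V : Set
  V = Fin n

  open Walks (adj Γ) public
  open Symmetric (adj-sym Γ) public

  adj⇒≢ : ∀ {x y} → adj Γ x y ≡ true → x ≢ y
  adj⇒≢ {x} e refl with trans (sym e) (irref Γ x)
  ... | ()

  cycleProduct-tabulate : ∀ {m} (s : V → V → Sign) (C : ChordlessCycle Γ m) →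
    cycleProduct s C ≡ ∏ (tabulate (λ i → s (c C i) (c C (next i))))
  cycleProduct-tabulate s C = cong ∏ (List.map-tabulate id (λ i → s (c C i) (c C (next i))))

  cycleProduct-walkSign : ∀ {m} (s : V → V → Sign) (C : ChordlessCycle Γ m) →
    cycleProduct s C ≡ walkSign s (c C zero) (tabulate (c C ∘ suc) ++ [ c C zero ])
  cycleProduct-walkSign s C = trans (cycleProduct-tabulate s C) (∏-cyclic≡walkSign s (c C))

  rotateCycle : ∀ {m} → ChordlessCycle Γ m → ℕ → ChordlessCycle Γ m
  rotateCycle C k = record
    { c = c C ∘ rotate k
    ; inj = rotate-injective k ∘ inj C
    ; edges = λ i j → edges C _ _ ∘ rotate-adjacent i j
    ; chords = λ i j → rotate-adjacent⁻ i j ∘ chords C _ _ }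
    where
    rotate-adjacent : ∀ i j → (j ≡ next i ⊎ i ≡ next j) → (rotate k j ≡ next (rotate k i) ⊎ rotate k i ≡ next (rotate k j))
    rotate-adjacent i j (inj₁ refl) = inj₁ (rotate-next k i)
    rotate-adjacent i j (inj₂ refl) = inj₂ (rotate-next k j)
    rotate-adjacent⁻ : ∀ i j → (rotate k j ≡ next (rotate k i) ⊎ rotate k i ≡ next (rotate k j)) → (j ≡ next i ⊎ i ≡ next j)
    rotate-adjacent⁻ i j (inj₁ e) = inj₁ (rotate-injective k (trans e (sym (rotate-next k i))))
    rotate-adjacent⁻ i j (inj₂ e) = inj₂ (rotate-injective k (trans e (sym (rotate-next k j))))

  cycleProduct-rotateCycle : ∀ {m} (s : V → V → Sign) (C : ChordlessCycle Γ m) k →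
    cycleProduct s (rotateCycle C k) ≡ cycleProduct s C
  cycleProduct-rotateCycle s C k = begin
    cycleProduct s (rotateCycle C k)                             ≡⟨ cycleProduct-tabulate s (rotateCycle C k) ⟩
    ∏ (tabulate (λ i → s (c C (rotate k i)) (c C (rotate k (next i)))))
      ≡⟨ cong ∏ (List.tabulate-cong (λ i → cong (s (c C (rotate k i)) ∘ c C) (rotate-next k i))) ⟩
    ∏ (tabulate ((λ i → s (c C i) (c C (next i))) ∘ rotate k))  ≡⟨ ∏-tabulate-rotate (λ i → s (c C i) (c C (next i))) k ⟩
    ∏ (tabulate (λ i → s (c C i) (c C (next i))))               ≡⟨ cycleProduct-tabulate s C ⟨
    cycleProduct s C                                             ∎
    where open ≡-Reasoning

  OnlyEnds : V → V → V → V → Set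
  OnlyEnds a b l z = adj Γ a z ≡ true → z ≡ b ⊎ z ≡ l

  onlyEnds? : ∀ a b l z → Dec (OnlyEnds a b l z)
  onlyEnds? a b l z with adj Γ a z Bool.≟ true | z Fin.≟ b | z Fin.≟ l
  ... | no ¬e | _ | _ = yes (⊥-elim ∘ ¬e)
  ... | yes _ | yes z≡b | _ = yes (λ _ → inj₁ z≡b)
  ... | yes _ | no _ | yes z≡l = yes (λ _ → inj₂ z≡l)
  ... | yes e | no z≢b | no z≢l = no (λ f → either z≢b z≢l (f e))

  -- The chordless cycle v, a, …, end a as, v, presented as the path a ∷ as seen from v.
  record CycleAt (v a : V) (as : List V) : Set where
    field
      walk : Walk a as
      chordless : Chordless a as
      unique : Unique (a ∷ as)
      v∉ : v ∉ a ∷ as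
      adj-head : adj Γ v a ≡ true
      adj-end : adj Γ v (end a as) ≡ true
      adj-only-ends : All (OnlyEnds v a (end a as)) (a ∷ as)
      nonempty : as ≢ []

  Link : V → V → V → Set
  Link v x y = Σ (List V) λ xs → CycleAt v x xs × end x xs ≡ y

  module ToCycle {v a q rest} (P : CycleAt v a (q ∷ rest)) where
    open CycleAt P

    private
      as : List V
      as = q ∷ rest

      g : Fin (3 + length rest) → V
      g = lookup (v ∷ a ∷ as)

      edge : ∀ i → adj Γ (g i) (g (next i)) ≡ true
      edge zero = subst (λ u → adj Γ v (g u) ≡ true) (sym next-zero) adj-head
      edge (suc k) with fromℕ-or-inject₁ k
      ... | inj₁ refl = subst (λ u → adj Γ (g (suc (fromℕ (length as)))) (g u) ≡ true) (sym (next-fromℕ (suc (length as))))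
            (trans (adj-sym Γ _ _) (subst (λ u → adj Γ v u ≡ true) (sym (lookup-fromℕ-length a as)) adj-end))
      ... | inj₂ (j , refl) = subst (λ u → adj Γ (g (suc (inject₁ j))) (g u) ≡ true) (sym (next-inject₁ (suc j)))
            (Walk-lookup⁻ a as walk j)

      chord-at-v : ∀ k → adj Γ v (lookup (a ∷ as) k) ≡ true → suc k ≡ next {2 + length rest} zero ⊎ zero ≡ next (suc k)
      chord-at-v k e with All.lookup adj-only-ends (∈-lookup k) e
      ... | inj₁ p = inj₁ (trans (cong suc (Unique-lookup-injective (a ∷ as) unique {k} {zero} p)) (sym next-zero))
      ... | inj₂ p = inj₂ (sym (trans (cong (next ∘ suc)
              (Unique-lookup-injective (a ∷ as) unique {k} {fromℕ (length as)} (trans p (sym (lookup-fromℕ-length a as)))))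
              (next-fromℕ (suc (length as)))))

      chord-off-v : ∀ k l → adj Γ (lookup (a ∷ as) k) (lookup (a ∷ as) l) ≡ true → suc l ≡ next (suc k) ⊎ suc k ≡ next (suc l)
      chord-off-v k l e with ℕ.<-cmp (toℕ k) (toℕ l)
      ... | tri≈ _ k≡l _ = ⊥-elim (adj⇒≢ e (cong (lookup (a ∷ as)) (Fin.toℕ-injective k≡l)))
      ... | tri< k<l _ _ with ℕ.m≤n⇒m<n∨m≡n k<l
      ...   | inj₁ k+1<l = ⊥-elim (true≢false (trans (sym e) (Chordless-lookup⁻ a as chordless k l k+1<l)))
      ...   | inj₂ k+1≡l = inj₁ (toℕ≡suc⇒≡next (suc k) (suc l) (cong suc (sym k+1≡l)))
      chord-off-v k l e | tri> _ _ l<k with ℕ.m≤n⇒m<n∨m≡n l<k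
      ...   | inj₁ l+1<k = ⊥-elim (true≢false (trans (sym (trans (adj-sym Γ _ _) e)) (Chordless-lookup⁻ a as chordless l k l+1<k)))
      ...   | inj₂ l+1≡k = inj₂ (toℕ≡suc⇒≡next (suc l) (suc k) (cong suc (sym l+1≡k)))

      chord : ∀ i j → adj Γ (g i) (g j) ≡ true → j ≡ next i ⊎ i ≡ next j
      chord zero zero e = ⊥-elim (adj⇒≢ e refl)
      chord zero (suc k) e = chord-at-v k e
      chord (suc k) zero e = Data.Sum.swap (chord-at-v k (trans (adj-sym Γ _ _) e))
      chord (suc k) (suc l) e = chord-off-v k l e

    cycle : ChordlessCycle Γ (length rest)
    cycle = record
      { c = g
      ; inj = Unique-lookup-injective (v ∷ a ∷ as) (All.¬Any⇒All¬ _ v∉ ∷ unique)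
      ; edges = λ { i j (inj₁ refl) → edge i ; i j (inj₂ refl) → trans (adj-sym Γ _ _) (edge j) }
      ; chords = chord }

    cycle-last : c cycle (fromℕ (2 + length rest)) ≡ end a as
    cycle-last = lookup-fromℕ-length a as

    cycleProduct-cycle : ∀ s → cycleProduct s cycle ≡ walkSign s v (a ∷ as ++ [ v ])
    cycleProduct-cycle s = trans (cycleProduct-walkSign s cycle)
      (cong (λ l → walkSign s v (l ++ [ v ])) (List.tabulate-lookup (a ∷ as)))

  fromCycle : ∀ {m} (C : ChordlessCycle Γ m) → CycleAt (c C zero) (c C (suc zero)) (tabulate (λ i → c C (suc (suc i))))
  fromCycle {m} C = record
    { walk = Walk-tabulate⁺ g (λ j → edges C (suc (inject₁ j)) (suc (suc j)) (inj₁ (sym (next-inject₁ (suc j)))))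
    ; chordless = Chordless-tabulate⁺ g no-chord
    ; unique = Unique.tabulate⁺ (Fin.suc-injective ∘ inj C)
    ; v∉ = λ m → case-zero (inj C (proj₂ (Any.tabulate⁻ {f = g} m)))
    ; adj-head = edges C zero (suc zero) (inj₁ (sym next-zero))
    ; adj-end = subst (λ u → adj Γ (c C zero) u ≡ true) (sym (end-tabulate g))
        (trans (adj-sym Γ _ _) (edges C (fromℕ (2 + m)) zero (inj₁ (sym (next-fromℕ (2 + m))))))
    ; adj-only-ends = All.tabulate⁺ only-ends
    ; nonempty = λ () }
    where
    g : Fin (2 + m) → V
    g = c C ∘ suc

    case-zero : ∀ {k} {i : Fin k} → zero ≢ suc i
    case-zero ()

    no-chord : ∀ (i j : Fin (2 + m)) → suc (suc (toℕ i)) ≤ toℕ j → adj Γ (g i) (g j) ≡ false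
    no-chord i j le = Bool.¬-not (far-apart⇒not-consecutive i j le ∘ chords C (suc i) (suc j))

    only-ends : ∀ i → adj Γ (c C zero) (g i) ≡ true → g i ≡ g zero ⊎ g i ≡ end (g zero) (tabulate (g ∘ suc))
    only-ends i e with chords C zero (suc i) e
    ... | inj₁ p = inj₁ (cong g (Fin.suc-injective (trans p next-zero)))
    ... | inj₂ p = inj₂ (trans (cong g (Fin.suc-injective (next≡zero⇒≡fromℕ (sym p)))) (sym (end-tabulate g)))

  CycleAt-reversed : ∀ {v a as} → CycleAt v a as → CycleAt v (end a as) (reverseTail a as)
  CycleAt-reversed {v} {a} {as} P = record
    { walk = Walk-reversed a as walk
    ; chordless = Chordless-reversed a as chordless
    ; unique = Unique-reversed a as unique
    ; v∉ = v∉ ∘ ∈-reversed⁻ a as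
    ; adj-head = adj-end
    ; adj-end = subst (λ u → adj Γ v u ≡ true) (sym (end-reverseTail a as)) adj-head
    ; adj-only-ends = All.tabulate (λ m e → swap-ends (All.lookup adj-only-ends (∈-reversed⁻ a as m) e))
    ; nonempty = reverseTail-nonempty as nonempty }
    where
    open CycleAt P
    swap-ends : ∀ {z} → z ≡ a ⊎ z ≡ end a as → z ≡ end a as ⊎ z ≡ end (end a as) (reverseTail a as)
    swap-ends (inj₁ e) = inj₂ (trans e (sym (end-reverseTail a as)))
    swap-ends (inj₂ e) = inj₁ e
    reverseTail-nonempty : ∀ bs → bs ≢ [] → reverseTail a bs ≢ []
    reverseTail-nonempty [] ne = ⊥-elim (ne refl)
    reverseTail-nonempty (y ∷ ys) _ e with reverseTail y ys
    ... | [] = case e of λ ()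
    ... | _ ∷ _ = case e of λ ()

  adj-end⇒single-edge : ∀ {x y ys} → Chordless x (y ∷ ys) → adj Γ x (end y ys) ≡ true → ys ≡ []
  adj-end⇒single-edge {ys = []} _ _ = refl
  adj-end⇒single-edge {ys = z ∷ zs} (nx ∷ᶜ _) e = ⊥-elim (true≢false (trans (sym e) (All.lookup nx (end-∈ z zs))))

  Beside : V → V → V → Set
  Beside v a z = z ≢ v × (adj Γ v z ≡ true → z ≡ a)

  beside-head : ∀ {x y ys} → Unique (x ∷ y ∷ ys) → Chordless x (y ∷ ys) → All (Beside x y) (y ∷ ys)
  beside-head {x} {y} {ys} u (nx ∷ᶜ _) = All.tabulate λ
    { (here refl) → (λ q → Unique[x∷xs]⇒x∉xs u (here (sym q))) , (λ _ → refl)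
    ; (there m) → (λ q → Unique[x∷xs]⇒x∉xs u (there (subst (_∈ ys) q m))) , (λ q → ⊥-elim (true≢false (trans (sym q) (All.lookup nx m)))) }

-- Balanced signings

Balanced : ∀ {V : Set} → (V → V → Bool) → (V → V → Sign) → Set
Balanced R s = ∀ a ws → Walks.Walk R a ws → end a ws ≡ a → walkSign s a ws ≡ pos

HasPotential : ∀ {V : Set} → (V → V → Bool) → (V → V → Sign) → Set
HasPotential {V} R s = Σ (V → Sign) λ X → ∀ u v → R u v ≡ true → s u v ≡ X u · X v

module _ {N : ℕ} (R : Fin (suc N) → Fin (suc N) → Bool) (s : Fin (suc N) → Fin (suc N) → Sign)
         (R-sym : ∀ u v → R u v ≡ R v u) (s-sym : ∀ u v → R u v ≡ true → s u v ≡ s v u) (balanced : Balanced R s) where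

  open Walks R

  private
    loop-sign : R zero zero ≡ true → s zero zero ≡ pos
    loop-sign e = trans (sym (*-identityʳ _)) (balanced zero [ zero ] (e ∷ʷ []ʷ) refl)

    triangle-sign : ∀ {x y} → R zero x ≡ true → R x y ≡ true → R y zero ≡ true → s y zero ≡ s zero x · s x y
    triangle-sign {x} {y} e₁ e₂ e₃ = sym (·≡pos⇒≡ (begin
      s zero x · s x y · s y zero            ≡⟨ *-assoc (s zero x) _ _ ⟩
      s zero x · (s x y · s y zero)          ≡⟨ cong (λ t → s zero x · (s x y · t)) (*-identityʳ _) ⟨
      walkSign s zero (x ∷ y ∷ [ zero ])     ≡⟨ balanced zero (x ∷ y ∷ [ zero ]) (e₁ ∷ʷ (e₂ ∷ʷ (e₃ ∷ʷ []ʷ))) refl ⟩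
      pos                                    ∎))
      where open ≡-Reasoning

  module Isolated (isolated : ∀ j → R zero (suc j) ≢ true) where

    R′ : Fin N → Fin N → Bool
    R′ i j = R (suc i) (suc j)

    s′ : Fin N → Fin N → Sign
    s′ i j = s (suc i) (suc j)

    balanced′ : Balanced R′ s′
    balanced′ a ws w e = trans (sym (walkSign-map a ws)) (balanced (suc a) (map suc ws) (Walk-map a ws w) (trans (end-map a ws) (cong suc e)))
      where
      Walk-map : ∀ i ws → Walks.Walk R′ i ws → Walk (suc i) (map suc ws)
      Walk-map i [] Walks.[]ʷ = []ʷ
      Walk-map i (j ∷ ws) (e Walks.∷ʷ w) = e ∷ʷ Walk-map j ws w
      end-map : ∀ i ws → end (suc i) (map suc ws) ≡ suc (end i ws)
      end-map i [] = refl
      end-map i (j ∷ ws) = end-map j ws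
      walkSign-map : ∀ i ws → walkSign s (suc i) (map suc ws) ≡ walkSign s′ i ws
      walkSign-map i [] = refl
      walkSign-map i (j ∷ ws) = cong (s (suc i) (suc j) ·_) (walkSign-map j ws)

    lift-potential : HasPotential R′ s′ → HasPotential R s
    lift-potential (Y , Y-potential) = X , X-potential
      where
      X : Fin (suc N) → Sign
      X zero = pos
      X (suc i) = Y i
      X-potential : ∀ u v → R u v ≡ true → s u v ≡ X u · X v
      X-potential zero zero e = loop-sign e
      X-potential zero (suc j) e = ⊥-elim (isolated j e)
      X-potential (suc i) zero e = ⊥-elim (isolated i (trans (R-sym zero (suc i)) e))
      X-potential (suc i) (suc j) e = Y-potential i j e

  -- Vertex 0 is merged into its neighbour u: each neighbour j of 0 becomes adjacent to u, with
  -- the sign of the walk u, 0, j.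
  module Contraction (u : Fin N) (r0u : R zero (suc u) ≡ true) where

    σ : Sign
    σ = s zero (suc u)

    R′ : Fin N → Fin N → Bool
    R′ i j with R (suc i) (suc j) | i Fin.≟ u | j Fin.≟ u
    ... | true | _ | _ = true
    ... | false | yes _ | _ = R zero (suc j)
    ... | false | no _ | yes _ = R (suc i) zero
    ... | false | no _ | no _ = false

    s′ : Fin N → Fin N → Sign
    s′ i j with R (suc i) (suc j) | i Fin.≟ u | j Fin.≟ u
    ... | true | _ | _ = s (suc i) (suc j)
    ... | false | yes _ | _ = σ · s zero (suc j)
    ... | false | no _ | yes _ = σ · s (suc i) zero
    ... | false | no _ | no _ = pos

    private
      ru0 : R (suc u) zero ≡ true
      ru0 = trans (R-sym (suc u) zero) r0u

      asymmetric⊥ : ∀ {i j} → R (suc i) (suc j) ≡ true → R (suc j) (suc i) ≡ false → ⊥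
      asymmetric⊥ e₁ e₂ = true≢false (trans (sym e₁) (trans (R-sym _ _) e₂))

    R′-sym : ∀ i j → R′ i j ≡ R′ j i
    R′-sym i j with R (suc i) (suc j) in e₁ | R (suc j) (suc i) in e₂ | i Fin.≟ u | j Fin.≟ u
    ... | true | true | _ | _ = refl
    ... | true | false | _ | _ = ⊥-elim (asymmetric⊥ e₁ e₂)
    ... | false | true | _ | _ = ⊥-elim (asymmetric⊥ e₂ e₁)
    ... | false | false | yes refl | yes refl = refl
    ... | false | false | yes refl | no _ = R-sym zero (suc j)
    ... | false | false | no _ | yes refl = R-sym (suc i) zero
    ... | false | false | no _ | no _ = refl

    s′-sym : ∀ i j → R′ i j ≡ true → s′ i j ≡ s′ j i
    s′-sym i j e with R (suc i) (suc j) in e₁ | R (suc j) (suc i) in e₂ | i Fin.≟ u | j Fin.≟ u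
    ... | true | true | _ | _ = s-sym _ _ e₁
    ... | true | false | _ | _ = ⊥-elim (asymmetric⊥ e₁ e₂)
    ... | false | true | _ | _ = ⊥-elim (asymmetric⊥ e₂ e₁)
    ... | false | false | yes refl | yes refl = refl
    ... | false | false | yes refl | no _ = cong (σ ·_) (s-sym _ _ e)
    ... | false | false | no _ | yes refl = cong (σ ·_) (s-sym _ _ e)
    ... | false | false | no _ | no _ = ⊥-elim (true≢false (sym e))

    RealisedBy : Fin N → Fin N → Sign → Set
    RealisedBy i j σ′ = Σ (List (Fin (suc N))) λ L →
      Walk (suc i) L × end (suc i) L ≡ suc j × walkSign s (suc i) L ≡ σ′

    realise-edge : ∀ i j → R′ i j ≡ true → RealisedBy i j (s′ i j)
    realise-edge i j e with R (suc i) (suc j) in eᵢⱼ | i Fin.≟ u | j Fin.≟ u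
    ... | true | _ | _ = [ suc j ] , eᵢⱼ ∷ʷ []ʷ , refl , *-identityʳ _
    ... | false | yes refl | _ = zero ∷ [ suc j ] , ru0 ∷ʷ (e ∷ʷ []ʷ) , refl ,
            cong₂ _·_ (s-sym (suc u) zero ru0) (*-identityʳ _)
    ... | false | no _ | yes refl = zero ∷ [ suc u ] , e ∷ʷ (r0u ∷ʷ []ʷ) , refl ,
            trans (cong (s (suc i) zero ·_) (*-identityʳ σ)) (*-comm _ σ)
    ... | false | no _ | no _ = ⊥-elim (true≢false (sym e))

    realise : ∀ i ws → Walks.Walk R′ i ws → RealisedBy i (end i ws) (walkSign s′ i ws)
    realise i [] w = [] , []ʷ , refl , refl
    realise i (j ∷ ws) (e Walks.∷ʷ w) with realise-edge i j e | realise j ws w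
    ... | L , wL , endL , signL | M , wM , endM , signM =
      L ++ M , Walk-++ L M wL (subst (λ x → Walk x M) (sym endL) wM) ,
      trans (end-++ (suc i) L M) (trans (cong (λ x → end x M) endL) endM) ,
      trans (walkSign-++ s (suc i) L M) (cong₂ _·_ signL (trans (cong (λ x → walkSign s x M) endL) signM))

    balanced′ : Balanced R′ s′
    balanced′ a ws w e with realise a ws w
    ... | L , wL , endL , signL = trans (sym signL) (balanced (suc a) L wL (trans endL (cong suc e)))

    old-edge : ∀ i j → R (suc i) (suc j) ≡ true → R′ i j ≡ true × s′ i j ≡ s (suc i) (suc j)
    old-edge i j e with R (suc i) (suc j) | i Fin.≟ u | j Fin.≟ u
    ... | true | _ | _ = refl , refl
    ... | false | _ | _ = ⊥-elim (true≢false (sym e))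

    edge-at-0 : ∀ {Y : Fin N → Sign} → (∀ i j → R′ i j ≡ true → s′ i j ≡ Y i · Y j) →
      ∀ j → R zero (suc j) ≡ true → s zero (suc j) ≡ σ · Y u · Y j
    edge-at-0 {Y} Y-potential j e with R (suc u) (suc j) in euj | u Fin.≟ u | j Fin.≟ u | Y-potential u j
    ... | true | _ | _ | Yuj = begin
      s zero (suc j)              ≡⟨ s-sym zero (suc j) e ⟩
      s (suc j) zero              ≡⟨ triangle-sign r0u euj (trans (R-sym (suc j) zero) e) ⟩
      σ · s (suc u) (suc j)       ≡⟨ cong (σ ·_) (Yuj refl) ⟩
      σ · (Y u · Y j)             ≡⟨ *-assoc σ (Y u) (Y j) ⟨
      σ · Y u · Y j               ∎
      where open ≡-Reasoning
    ... | false | yes _ | _ | Yuj = begin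
      s zero (suc j)              ≡⟨ cong (_· s zero (suc j)) (s*s≡+ σ) ⟨
      σ · σ · s zero (suc j)      ≡⟨ *-assoc σ σ _ ⟩
      σ · (σ · s zero (suc j))    ≡⟨ cong (σ ·_) (Yuj e) ⟩
      σ · (Y u · Y j)             ≡⟨ *-assoc σ (Y u) (Y j) ⟨
      σ · Y u · Y j               ∎
      where open ≡-Reasoning
    ... | false | no u≢u | _ | _ = ⊥-elim (u≢u refl)

    lift-potential : HasPotential R′ s′ → HasPotential R s
    lift-potential (Y , Y-potential) = X , X-potential
      where
      X : Fin (suc N) → Sign
      X zero = σ · Y u
      X (suc i) = Y i
      X-potential : ∀ v w → R v w ≡ true → s v w ≡ X v · X w
      X-potential zero zero e = trans (loop-sign e) (sym (s*s≡+ (X zero)))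
      X-potential zero (suc j) e = edge-at-0 Y-potential j e
      X-potential (suc i) zero e =
        trans (s-sym _ _ e) (trans (edge-at-0 Y-potential i (trans (R-sym _ _) e)) (*-comm (X zero) (X (suc i))))
      X-potential (suc i) (suc j) e with old-edge i j e
      ... | R′ij , s′ij = trans (sym s′ij) (Y-potential i j R′ij)

balanced⇒potential : ∀ N (R : Fin N → Fin N → Bool) (s : Fin N → Fin N → Sign) →
  (∀ u v → R u v ≡ R v u) → (∀ u v → R u v ≡ true → s u v ≡ s v u) → Balanced R s → HasPotential R s
balanced⇒potential zero R s R-sym s-sym balanced = (λ ()) , (λ ())
balanced⇒potential (suc N) R s R-sym s-sym balanced with Fin.any? (λ j → R zero (suc j) Bool.≟ true)
... | no isolated =
  lift-potential (balanced⇒potential N R′ s′ (λ i j → R-sym (suc i) (suc j)) (λ i j → s-sym (suc i) (suc j)) balanced′)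
  where open Isolated R s R-sym s-sym balanced (λ j e → isolated (j , e))
... | yes (u , r0u) = lift-potential (balanced⇒potential N R′ s′ R′-sym s′-sym balanced′)
  where open Contraction R s R-sym s-sym balanced u r0u

-- Splitting closed walks

module _ {A : Set} where

  Any-split : ∀ {P : A → Set} {xs} → Any P xs → ∃ λ pre → ∃ λ x → ∃ λ post → xs ≡ pre ++ x ∷ post × P x
  Any-split p with find p
  ... | x , m , px with ∈-∃++ m
  ... | pre , post , e = pre , x , post , e , px

  unique-or-repeat : DecidableEquality A → ∀ (ws : List A) →
    Unique ws ⊎ ∃ λ p → ∃ λ z → ∃ λ q → ∃ λ r → ws ≡ p ++ z ∷ q ++ z ∷ r
  unique-or-repeat _≟_ [] = inj₁ []
  unique-or-repeat _≟_ (x ∷ xs) with DecMembership._∈?_ _≟_ x xs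
  ... | yes x∈xs with ∈-∃++ x∈xs
  ...   | q , r , e = inj₂ ([] , x , q , r , cong (x ∷_) e)
  unique-or-repeat _≟_ (x ∷ xs) | no x∉xs with unique-or-repeat _≟_ xs
  ... | inj₁ u = inj₁ (All.¬Any⇒All¬ xs x∉xs ∷ u)
  ... | inj₂ (p , z , q , r , e) = inj₂ (x ∷ p , z , q , r , cong (x ∷_) e)

  length-<-++-∷ : ∀ (xs : List A) y ys → length ys < length (xs ++ y ∷ ys)
  length-<-++-∷ [] y ys = ℕ.n<1+n (length ys)
  length-<-++-∷ (x ∷ xs) y ys = ℕ.m<n⇒m<1+n (length-<-++-∷ xs y ys)

  length-++-monoʳ-< : ∀ (xs : List A) {ys zs} → length ys < length zs → length (xs ++ ys) < length (xs ++ zs)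
  length-++-monoʳ-< xs {ys} {zs} lt =
    subst₂ _<_ (sym (List.length-++ xs)) (sym (List.length-++ xs)) (ℕ.+-monoʳ-< (length xs) lt)

  length-++-monoʳ-≤ : ∀ (xs : List A) {ys zs} → length ys ≤ length zs → length (xs ++ ys) ≤ length (xs ++ zs)
  length-++-monoʳ-≤ xs {ys} {zs} le =
    subst₂ _≤_ (sym (List.length-++ xs)) (sym (List.length-++ xs)) (ℕ.+-monoʳ-≤ (length xs) le)

module _ {n : ℕ} (Γ : Graph n) where
  open OnGraph Γ

  record Chord (xs : List V) : Set where
    field
      pre : List V
      u : V
      m : V
      M : List V
      z : V
      post : List V
      decomposition : xs ≡ pre ++ u ∷ (m ∷ M) ++ z ∷ post
      adjacent : adj Γ u z ≡ true

  Chordless-or-Chord : ∀ x xs → Chordless x xs ⊎ Chord (x ∷ xs)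
  Chordless-or-Chord x [] = inj₁ []ᶜ
  Chordless-or-Chord x (y ∷ ys) with All.all? (λ z → adj Γ x z Bool.≟ false) ys
  ... | no has-chord with Any-split (All.¬All⇒Any¬ (λ z → adj Γ x z Bool.≟ false) ys has-chord)
  ...   | mid , z , post , e , p = inj₂ (record
          { pre = [] ; u = x ; m = y ; M = mid ; z = z ; post = post
          ; decomposition = cong (λ t → x ∷ y ∷ t) e ; adjacent = Bool.¬-not p })
  Chordless-or-Chord x (y ∷ ys) | yes no-chord with Chordless-or-Chord y ys
  ... | inj₁ c = inj₁ (no-chord ∷ᶜ c)
  ... | inj₂ ch = inj₂ (record
          { pre = x ∷ Chord.pre ch ; u = Chord.u ch ; m = Chord.m ch ; M = Chord.M ch ; z = Chord.z ch
          ; post = Chord.post ch ; decomposition = cong (x ∷_) (Chord.decomposition ch) ; adjacent = Chord.adjacent ch })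

  record InnerNeighbour (a : V) (xs : List V) : Set where
    field
      p : V
      pre : List V
      z : V
      q : V
      post : List V
      decomposition : xs ≡ (p ∷ pre) ++ z ∷ (q ∷ post)
      adjacent : adj Γ a z ≡ true

  OnlyEnds-or-InnerNeighbour : ∀ a b bs → All (OnlyEnds a b (end b bs)) (b ∷ bs) ⊎ InnerNeighbour a (b ∷ bs)
  OnlyEnds-or-InnerNeighbour a b bs with All.all? (onlyEnds? a b (end b bs)) (b ∷ bs)
  ... | yes only = inj₁ only
  ... | no ¬only with Any-split (All.¬All⇒Any¬ (onlyEnds? a b (end b bs)) (b ∷ bs) ¬only)
  ...   | pre , z , post , split , ¬onlyz with adj Γ a z Bool.≟ true
  ...     | no ¬az = ⊥-elim (¬onlyz (⊥-elim ∘ ¬az))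
  ...     | yes az = inj₂ (inner pre post split az)
    where
    z≢b : z ≢ b
    z≢b z≡b = ¬onlyz (λ _ → inj₁ z≡b)
    z≢end : z ≢ end b bs
    z≢end z≡end = ¬onlyz (λ _ → inj₂ z≡end)
    inner : ∀ pre post → b ∷ bs ≡ pre ++ z ∷ post → adj Γ a z ≡ true → InnerNeighbour a (b ∷ bs)
    inner [] post e′ _ = ⊥-elim (z≢b (sym (List.∷-injectiveˡ e′)))
    inner (p ∷ pre′) [] e′ _ =
      ⊥-elim (z≢end (sym (trans (cong (end b) (List.∷-injectiveʳ e′)) (end-++ b pre′ [ z ]))))
    inner (p ∷ pre′) (q ∷ post′) e′ az = record
      { p = p ; pre = pre′ ; z = z ; q = q ; post = post′ ; decomposition = e′ ; adjacent = az }

  ClosedWalk : V → List V → Set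
  ClosedWalk a ws = Walk a ws × end a ws ≡ a

  module _ (s : V → V → Sign) (s-sym : ∀ u v → adj Γ u v ≡ true → s u v ≡ s v u) where

    record Split (a : V) (ws : List V) : Set where
      field
        a₁ a₂ : V
        ws₁ ws₂ : List V
        closed₁ : ClosedWalk a₁ ws₁
        closed₂ : ClosedWalk a₂ ws₂
        shorter₁ : length ws₁ < length ws
        shorter₂ : length ws₂ < length ws
        sign : walkSign s a ws ≡ walkSign s a₁ ws₁ · walkSign s a₂ ws₂

    split-at-repeat : ∀ a p z q r → ClosedWalk a (p ++ z ∷ q ++ z ∷ r) → Split a (p ++ z ∷ q ++ z ∷ r)
    split-at-repeat a p z q r (w , closed) with Walk-split p (q ++ z ∷ r) w
    ... | wp , e₁ , wz with Walk-split q r wz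
    ...   | wq , e₂ , wr = record
      { a₁ = a ; ws₁ = p ++ z ∷ r ; a₂ = z ; ws₂ = q ++ [ z ]
      ; closed₁ = Walk-++ p (z ∷ r) wp (e₁ ∷ʷ wr) , (begin
          end a (p ++ z ∷ r)             ≡⟨ end-++ a p (z ∷ r) ⟩
          end z r                        ≡⟨ end-++ z q (z ∷ r) ⟨
          end z (q ++ z ∷ r)             ≡⟨ end-++ a p (z ∷ q ++ z ∷ r) ⟨
          end a (p ++ z ∷ q ++ z ∷ r)    ≡⟨ closed ⟩
          a                              ∎)
      ; closed₂ = Walk-++ q [ z ] wq (e₂ ∷ʷ []ʷ) , end-++ z q [ z ]
      ; shorter₁ = length-++-monoʳ-< p (s≤s (length-<-++-∷ q z r))
      ; shorter₂ = ℕ.≤-<-trans (length-++-monoʳ-≤ q (s≤s z≤n)) (length-<-++-∷ p z (q ++ z ∷ r))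
      ; sign = begin
          walkSign s a (p ++ z ∷ q ++ z ∷ r)     ≡⟨ walkSign-++ s a p _ ⟩
          P · (S₁ · walkSign s z (q ++ z ∷ r))  ≡⟨ cong (λ t → P · (S₁ · t)) (walkSign-++ s z q (z ∷ r)) ⟩
          P · (S₁ · (Q · (S₂ · R)))             ≡⟨ ·-rearrange P S₁ Q S₂ R ⟩
          (P · (S₁ · R)) · (Q · (S₂ · pos))     ≡⟨ cong₂ _·_ (walkSign-++ s a p (z ∷ r)) (walkSign-++ s z q [ z ]) ⟨
          walkSign s a (p ++ z ∷ r) · walkSign s z (q ++ [ z ]) ∎ }
      where
      open ≡-Reasoning
      P Q R S₁ S₂ : Sign
      P = walkSign s a p
      Q = walkSign s z q
      R = walkSign s z r
      S₁ = s (end a p) z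
      S₂ = s (end z q) z
      ·-rearrange : ∀ P S₁ Q S₂ R → P · (S₁ · (Q · (S₂ · R))) ≡ (P · (S₁ · R)) · (Q · (S₂ · pos))
      ·-rearrange = solve 5 (λ P S₁ Q S₂ R → P ⊕ (S₁ ⊕ (Q ⊕ (S₂ ⊕ R))) ⊜ (P ⊕ (S₁ ⊕ R)) ⊕ (Q ⊕ (S₂ ⊕ ε))) refl

    -- The edge from u = end a pre to z bypasses m ∷ M; the bound on pre and post makes both pieces shorter.
    split-at-shortcut : ∀ a pre m M z post → 2 ≤ length pre + length post → adj Γ (end a pre) z ≡ true →
      ClosedWalk a (pre ++ (m ∷ M) ++ z ∷ post) → Split a (pre ++ (m ∷ M) ++ z ∷ post)
    split-at-shortcut a pre m M z post long uz (w , closed) with Walk-++⁻ pre _ w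
    ... | wpre , wrest with Walk-split (m ∷ M) post wrest
    ...   | wM , e , wpost = record
      { a₁ = a ; ws₁ = pre ++ z ∷ post ; a₂ = u ; ws₂ = (m ∷ M) ++ z ∷ [ u ]
      ; closed₁ = Walk-++ pre (z ∷ post) wpre (uz ∷ʷ wpost) , (begin
          end a (pre ++ z ∷ post)                 ≡⟨ end-++ a pre (z ∷ post) ⟩
          end z post                              ≡⟨ end-++ u (m ∷ M) (z ∷ post) ⟨
          end u ((m ∷ M) ++ z ∷ post)             ≡⟨ end-++ a pre ((m ∷ M) ++ z ∷ post) ⟨
          end a (pre ++ (m ∷ M) ++ z ∷ post)      ≡⟨ closed ⟩
          a                                       ∎)
      ; closed₂ = Walk-++ (m ∷ M) (z ∷ [ u ]) wM (e ∷ʷ (trans (adj-sym Γ z u) uz ∷ʷ []ʷ)) , end-++ u (m ∷ M) (z ∷ [ u ])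
      ; shorter₁ = length-++-monoʳ-< pre (s≤s (List.length-++-≤ʳ (z ∷ post) {M}))
      ; shorter₂ = subst₂ _<_ (sym (List.length-++ (m ∷ M)))
                     (sym (trans (List.length-++ pre) (cong (length pre +_) (List.length-++ (m ∷ M)))))
                     (detour-shorter (length pre) (length (m ∷ M)) (length post) long)
      ; sign = begin
          walkSign s a (pre ++ (m ∷ M) ++ z ∷ post)      ≡⟨ walkSign-++ s a pre _ ⟩
          P · walkSign s u ((m ∷ M) ++ z ∷ post)          ≡⟨ cong (P ·_) (walkSign-++ s u (m ∷ M) (z ∷ post)) ⟩
          P · (D · (S · Z))                               ≡⟨ *-identityʳ _ ⟨
          P · (D · (S · Z)) · pos                         ≡⟨ cong (P · (D · (S · Z)) ·_) (s*s≡+ C) ⟨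
          P · (D · (S · Z)) · (C · C)                     ≡⟨ ·-rearrange P D S Z C ⟩
          (P · (C · Z)) · (D · (S · (C · pos)))           ≡⟨ cong (λ t → (P · (C · Z)) · (D · (S · (t · pos)))) (s-sym u z uz) ⟩
          (P · (C · Z)) · (D · (S · (s z u · pos)))
            ≡⟨ cong₂ _·_ (walkSign-++ s a pre (z ∷ post)) (walkSign-++ s u (m ∷ M) (z ∷ [ u ])) ⟨
          walkSign s a (pre ++ z ∷ post) · walkSign s u ((m ∷ M) ++ z ∷ [ u ]) ∎ }
      where
      open ≡-Reasoning
      u : V
      u = end a pre
      P D S Z C : Sign
      P = walkSign s a pre
      D = walkSign s u (m ∷ M)
      S = s (end u (m ∷ M)) z
      Z = walkSign s z post
      C = s u z
      ·-rearrange : ∀ P D S Z C → P · (D · (S · Z)) · (C · C) ≡ (P · (C · Z)) · (D · (S · (C · pos)))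
      ·-rearrange = solve 5 (λ P D S Z C → (P ⊕ (D ⊕ (S ⊕ Z))) ⊕ (C ⊕ C) ⊜ (P ⊕ (C ⊕ Z)) ⊕ (D ⊕ (S ⊕ (C ⊕ ε)))) refl
      detour-shorter : ∀ p k q → 2 ≤ p + q → k + 2 < p + (k + suc q)
      detour-shorter p k q le = subst (k + 2 <_) (+-rearrange p k q) (ℕ.+-monoʳ-< k (s≤s le))
        where
        +-rearrange : ∀ p k q → k + suc (p + q) ≡ p + (k + suc q)
        +-rearrange = solve-∀

    split-at-chord : ∀ a b bs → Walk a (b ∷ bs ++ [ a ]) → Chord (b ∷ bs) → Split a (b ∷ bs ++ [ a ])
    split-at-chord a b bs w ch = subst (Split a) (sym ws≡)
      (split-at-shortcut a (pre ++ [ u ]) m M z (post ++ [ a ]) long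
        (subst (λ x → adj Γ x z ≡ true) (sym (end-++ a pre [ u ])) adjacent)
        (subst (ClosedWalk a) ws≡ (w , end-++ b bs [ a ])))
      where
      open Chord ch
      ws≡ : b ∷ bs ++ [ a ] ≡ (pre ++ [ u ]) ++ (m ∷ M) ++ z ∷ (post ++ [ a ])
      ws≡ = begin
        (b ∷ bs) ++ [ a ]                                ≡⟨ cong (_++ [ a ]) decomposition ⟩
        (pre ++ u ∷ (m ∷ M) ++ z ∷ post) ++ [ a ]        ≡⟨ List.++-assoc pre (u ∷ (m ∷ M) ++ z ∷ post) [ a ] ⟩
        pre ++ u ∷ ((m ∷ M) ++ z ∷ post) ++ [ a ]        ≡⟨ cong (λ t → pre ++ u ∷ t) (List.++-assoc (m ∷ M) (z ∷ post) [ a ]) ⟩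
        pre ++ u ∷ (m ∷ M) ++ z ∷ (post ++ [ a ])        ≡⟨ List.++-assoc pre [ u ] _ ⟨
        (pre ++ [ u ]) ++ (m ∷ M) ++ z ∷ (post ++ [ a ]) ∎
        where open ≡-Reasoning
      long : 2 ≤ length (pre ++ [ u ]) + length (post ++ [ a ])
      long = ℕ.+-mono-≤ (List.length-++-≤ʳ [ u ] {pre}) (List.length-++-≤ʳ [ a ] {post})

    split-at-inner-neighbour : ∀ a b bs → Walk a (b ∷ bs ++ [ a ]) → InnerNeighbour a (b ∷ bs) → Split a (b ∷ bs ++ [ a ])
    split-at-inner-neighbour a b bs w inner = subst (Split a) (sym ws≡)
      (split-at-shortcut a [] p pre z (q ∷ post ++ [ a ]) (s≤s (List.length-++-≤ʳ [ a ] {post})) adjacent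
        (subst (ClosedWalk a) ws≡ (w , end-++ b bs [ a ])))
      where
      open InnerNeighbour inner
      ws≡ : b ∷ bs ++ [ a ] ≡ (p ∷ pre) ++ z ∷ (q ∷ post ++ [ a ])
      ws≡ = trans (cong (_++ [ a ]) decomposition) (List.++-assoc (p ∷ pre) (z ∷ q ∷ post) [ a ])

    back-and-forth : ∀ {a b} → adj Γ a b ≡ true → walkSign s a (b ∷ [ a ]) ≡ pos
    back-and-forth {a} {b} ab = begin
      s a b · (s b a · pos)   ≡⟨ cong (s a b ·_) (*-identityʳ _) ⟩
      s a b · s b a           ≡⟨ cong (s a b ·_) (s-sym a b ab) ⟨
      s a b · s a b           ≡⟨ s*s≡+ (s a b) ⟩
      pos                     ∎
      where open ≡-Reasoning

    module _ (positive : ∀ {v a as} → CycleAt v a as → walkSign s v (a ∷ as ++ [ v ]) ≡ pos) where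

      private
        Settled : V → List V → Set
        Settled a ws = Split a ws ⊎ walkSign s a ws ≡ pos

      settle-path : ∀ a b bs → Walk a (b ∷ bs ++ [ a ]) → Unique (b ∷ bs ++ [ a ]) → Settled a (b ∷ bs ++ [ a ])
      settle-path a b [] (ab ∷ʷ _) _ = inj₂ (back-and-forth ab)
      settle-path a b (c ∷ cs) w u with Chordless-or-Chord b (c ∷ cs)
      ... | inj₂ ch = inj₁ (split-at-chord a b (c ∷ cs) w ch)
      ... | inj₁ chordless with OnlyEnds-or-InnerNeighbour a b (c ∷ cs)
      ...   | inj₂ inner = inj₁ (split-at-inner-neighbour a b (c ∷ cs) w inner)
      ...   | inj₁ only with w | Unique-++⁻ (b ∷ c ∷ cs) [ a ] u
      ...     | ab ∷ʷ w′ | u′ , disjoint = inj₂ (positive (record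
          { walk = proj₁ (Walk-++⁻ (c ∷ cs) [ a ] w′)
          ; chordless = chordless
          ; unique = u′
          ; v∉ = λ m → disjoint m (here refl)
          ; adj-head = ab
          ; adj-end = trans (adj-sym Γ _ _) (last-edge (proj₂ (Walk-++⁻ (c ∷ cs) [ a ] w′)))
          ; adj-only-ends = only
          ; nonempty = λ () }))
        where
        last-edge : ∀ {x y} → Walk x [ y ] → adj Γ x y ≡ true
        last-edge (e ∷ʷ _) = e

      settle : ∀ a ws → ClosedWalk a ws → Settled a ws
      settle a [] _ = inj₂ refl
      settle a (b ∷ bs) (w , closed) with unique-or-repeat Fin._≟_ (b ∷ bs) | front-end b bs
      ... | inj₂ (p , z , q , r , e) | _ = inj₁ (subst (Split a) (sym e) (split-at-repeat a p z q r (subst (ClosedWalk a) e (w , closed))))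
      ... | inj₁ u | e with front b bs
      ...   | [] = ⊥-elim (adj⇒≢ (first-edge w) (sym (trans (List.∷-injectiveˡ e) closed)))
        where
        first-edge : ∀ {x y ys} → Walk x (y ∷ ys) → adj Γ x y ≡ true
        first-edge (e ∷ʷ _) = e
      ...   | c ∷ cs = subst (Settled a) (sym ws≡) (settle-path a c cs (subst (Walk a) ws≡ w) (subst Unique ws≡ u))
        where
        ws≡ : b ∷ bs ≡ c ∷ cs ++ [ a ]
        ws≡ = trans e (cong (λ x → c ∷ cs ++ [ x ]) closed)

      balanced-below : ∀ k a ws → length ws < k → ClosedWalk a ws → walkSign s a ws ≡ pos
      balanced-below (suc k) a ws (s≤s le) cw with settle a ws cw
      ... | inj₂ p = p
      ... | inj₁ S = trans sign (cong₂ _·_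
              (balanced-below k a₁ ws₁ (ℕ.<-≤-trans shorter₁ le) closed₁)
              (balanced-below k a₂ ws₂ (ℕ.<-≤-trans shorter₂ le) closed₂))
        where open Split S

      chordless-positive⇒balanced : Balanced (adj Γ) s
      chordless-positive⇒balanced a ws w closed = balanced-below (suc (length ws)) a ws ℕ.≤-refl (w , closed)

-- Uniqueness up to switching

toBool : Sign → Bool
toBool pos = false
toBool neg = true

flipSign-toBool : ∀ x → flipSign (toBool x) ≡ x
flipSign-toBool pos = refl
flipSign-toBool neg = refl

module _ {n : ℕ} (Γ : Graph n) where
  open OnGraph Γ

  CycleAt-negative : ∀ (s : V → V → Sign) → AllChordlessNegative Γ s → ∀ {v a as} → CycleAt v a as →
    walkSign s v (a ∷ as ++ [ v ]) ≡ neg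
  CycleAt-negative s negative {as = []} P = ⊥-elim (CycleAt.nonempty P refl)
  CycleAt-negative s negative {as = q ∷ rest} P = trans (sym (cycleProduct-cycle s)) (negative _ cycle)
    where open ToCycle P

  uniqueness : ∀ (s t : Signing Γ) → AllChordlessNegative Γ (proj₁ s) → AllChordlessNegative Γ (proj₁ t) →
    SwitchingEquivalent Γ (proj₁ s) (proj₁ t)
  uniqueness (s , s-sym) (t , t-sym) s-negative t-negative = toBool ∘ X , switched
    where
    r : V → V → Sign
    r u v = s u v · t u v

    r-positive : ∀ {v a as} → CycleAt v a as → walkSign r v (a ∷ as ++ [ v ]) ≡ pos
    r-positive {v} {a} {as} P = trans (walkSign-· s t v (a ∷ as ++ [ v ]))
      (cong₂ _·_ (CycleAt-negative s s-negative P) (CycleAt-negative t t-negative P))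

    r-sym : ∀ u v → adj Γ u v ≡ true → r u v ≡ r v u
    r-sym u v e = cong₂ _·_ (s-sym u v e) (t-sym u v e)

    potential : HasPotential (adj Γ) r
    potential = balanced⇒potential n (adj Γ) r (adj-sym Γ) r-sym (chordless-positive⇒balanced Γ r r-sym r-positive)

    X : V → Sign
    X = proj₁ potential

    switched : ∀ u v → adj Γ u v ≡ true → t u v ≡ switch (toBool ∘ X) s u v
    switched u v e = begin
      t u v                       ≡⟨ cong (_· t u v) (s*s≡+ (s u v)) ⟨
      s u v · s u v · t u v       ≡⟨ *-assoc (s u v) (s u v) (t u v) ⟩
      s u v · r u v               ≡⟨ cong (s u v ·_) (proj₂ potential u v e) ⟩
      s u v · (X u · X v)         ≡⟨ *-assoc (s u v) (X u) (X v) ⟨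
      s u v · X u · X v           ≡⟨ cong₂ (λ a b → s u v · a · b) (flipSign-toBool (X u)) (flipSign-toBool (X v)) ⟨
      switch (toBool ∘ X) s u v   ∎
      where open ≡-Reasoning

-- Induced paths inside walks

module _ {A : Set} {P : A → Set} (P? : ∀ x → Dec (P x)) where

  last-satisfying : ∀ xs →
    All (¬_ ∘ P) xs ⊎ ∃ λ pre → ∃ λ x → ∃ λ rest → xs ≡ pre ++ x ∷ rest × P x × All (¬_ ∘ P) rest
  last-satisfying [] = inj₁ []
  last-satisfying (y ∷ ys) with last-satisfying ys
  ... | inj₂ (pre , x , rest , e , px , none) = inj₂ (y ∷ pre , x , rest , cong (y ∷_) e , px , none)
  ... | inj₁ none with P? y
  ...   | yes py = inj₂ ([] , y , ys , refl , py , none)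
  ...   | no ¬py = inj₁ (¬py ∷ none)

module _ {n : ℕ} (Γ : Graph n) where
  open OnGraph Γ

  record InducedPath (a : V) (ws : List V) : Set where
    field
      path : List V
      walk : Walk a path
      chordless : Chordless a path
      unique : Unique (a ∷ path)
      same-end : end a path ≡ end a ws
      within : All (_∈ a ∷ ws) path

  private
    Touches : V → V → Set
    Touches a z = z ≡ a ⊎ adj Γ a z ≡ true

    touches? : ∀ a z → Dec (Touches a z)
    touches? a z with z Fin.≟ a | adj Γ a z Bool.≟ true
    ... | yes z≡a | _ = yes (inj₁ z≡a)
    ... | no _ | yes az = yes (inj₂ az)
    ... | no z≢a | no ¬az = no (either z≢a ¬az)

    trivial : ∀ a ws → a ≡ end a ws → InducedPath a ws
    trivial a ws e = record { path = [] ; walk = []ʷ ; chordless = []ᶜ ; unique = [] ∷ [] ; same-end = e ; within = [] }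

    -- Cut the walk at the last vertex x equal or adjacent to a; what follows x avoids a and its neighbours.
    induced-path-below : ∀ k a ws → length ws ≤ k → Walk a ws → InducedPath a ws
    induced-path-below k a [] _ _ = trivial a [] refl
    induced-path-below k a (y ∷ ys) le w@(ay ∷ʷ _) with last-satisfying (touches? a) (y ∷ ys)
    ... | inj₁ (¬ty ∷ _) = ⊥-elim (¬ty (inj₂ ay))
    ... | inj₂ (pre , x , [] , e , inj₁ refl , _) = trivial a (y ∷ ys) (sym (trans (cong (end a) e) (end-++ a pre [ a ])))
    ... | inj₂ (pre , x , r ∷ rs , e , inj₁ refl , ¬tr ∷ _) with Walk-split pre (r ∷ rs) (subst (Walk a) e w)
    ...   | _ , _ , (ar ∷ʷ _) = ⊥-elim (¬tr (inj₂ ar))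
    induced-path-below (suc k) a (y ∷ ys) le w | inj₂ (pre , x , rest , e , inj₂ ax , none) = record
      { path = x ∷ path
      ; walk = ax ∷ʷ walk
      ; chordless = All.tabulate (λ m → Bool.¬-not (λ az → All.lookup none (in-rest m) (inj₂ az))) ∷ᶜ chordless
      ; unique = All.¬Any⇒All¬ _ a∉ ∷ unique
      ; same-end = trans same-end (trans (sym (end-++ a pre (x ∷ rest))) (cong (end a) (sym e)))
      ; within = in-ws (here refl) ∷ All.map in-ws within }
      where
      rest-shorter : length rest ≤ k
      rest-shorter = ℕ.≤-pred (ℕ.≤-trans (ℕ.≤-trans (length-<-++-∷ pre x rest) (ℕ.≤-reflexive (cong length (sym e)))) le)
      open InducedPath (induced-path-below k x rest rest-shorter (proj₂ (proj₂ (Walk-split pre rest (subst (Walk a) e w)))))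
      in-ws : ∀ {z} → z ∈ x ∷ rest → z ∈ a ∷ y ∷ ys
      in-ws m = there (subst (_ ∈_) (sym e) (Any.++⁺ʳ pre m))
      in-rest : ∀ {z} → z ∈ path → z ∈ rest
      in-rest m with All.lookup within m
      ... | here refl = ⊥-elim (Unique[x∷xs]⇒x∉xs unique m)
      ... | there m′ = m′
      a∉ : a ∉ x ∷ path
      a∉ (here a≡x) = adj⇒≢ ax a≡x
      a∉ (there m) = All.lookup none (in-rest m) (inj₁ refl)

  induced-path : ∀ a ws → Walk a ws → InducedPath a ws
  induced-path a ws = induced-path-below (length ws) a ws ℕ.≤-refl

-- Cyclic orientations

module Cyclic {n : ℕ} (Γ : Graph n) (co : CyclicallyOrientable Γ) where
  open OnGraph Γ

  dir : V → V → Bool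
  dir = proj₁ (proj₁ co)

  module Dir = Walks dir

  dir-asym : ∀ {u v} → adj Γ u v ≡ true → dir u v ≡ true → dir v u ≡ true → ⊥
  dir-asym {u} {v} e uv vu = true≢false (trans (sym vu) (trans (proj₂ (proj₁ co) u v e) (cong not uv)))

  dir-flip : ∀ {u v} → adj Γ u v ≡ true → dir u v ≡ false → dir v u ≡ true
  dir-flip {u} {v} e uv = trans (proj₂ (proj₁ co) u v e) (cong not uv)

  record Forward (v a : V) (as : List V) : Set where
    field
      path : Dir.Walk a as
      back : dir (end a as) v ≡ true

  CycleAt-forward : ∀ {v a as} → CycleAt v a as → dir v a ≡ true → Forward v a as
  CycleAt-forward {as = []} P _ = ⊥-elim (CycleAt.nonempty P refl)
  CycleAt-forward {v} {a} {q ∷ rest} P va with proj₂ co _ cycle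
    where open ToCycle P
  ... | inj₂ backward = ⊥-elim (dir-asym (CycleAt.adj-head P) va (subst (λ u → dir (c cycle u) v ≡ true) next-zero (backward zero)))
    where open ToCycle P
  ... | inj₁ forward = record
    { path = Dir.Walk-lookup⁺ a (q ∷ rest)
        (λ j → subst (λ u → dir (c cycle (suc (inject₁ j))) (c cycle u) ≡ true) (next-inject₁ (suc j)) (forward (suc (inject₁ j))))
    ; back = subst (λ u → dir u v ≡ true) cycle-last
        (subst (λ u → dir (c cycle (fromℕ (2 + length rest))) (c cycle u) ≡ true) (next-fromℕ (2 + length rest)) (forward (fromℕ _))) }
    where open ToCycle P

  -- An induced path inside the walk would close up, through v, to a chordless cycle leaving v twice.
  no-walk-between-out-neighbours : ∀ v a ws → a ≢ end a ws → adj Γ v a ≡ true → adj Γ v (end a ws) ≡ true →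
    dir v a ≡ true → dir v (end a ws) ≡ true → Walk a ws →
    All (_≢ v) (a ∷ ws) → All (OnlyEnds v a (end a ws)) (a ∷ ws) → ⊥
  no-walk-between-out-neighbours v a ws a≢b va vb dva dvb w avoid only =
    dir-asym vb dvb (subst (λ u → dir u v ≡ true) same-end (Forward.back (CycleAt-forward P dva)))
    where
    open InducedPath (induced-path Γ a ws w)
    within′ : All (_∈ a ∷ ws) (a ∷ path)
    within′ = here refl ∷ within
    P : CycleAt v a path
    P = record
      { walk = walk ; chordless = chordless ; unique = unique
      ; v∉ = λ m → All.lookup avoid (All.lookup within′ m) refl
      ; adj-head = va
      ; adj-end = subst (λ u → adj Γ v u ≡ true) (sym same-end) vb
      ; adj-only-ends = All.tabulate (λ m e → Data.Sum.map₂ (λ q → trans q (sym same-end)) (All.lookup only (All.lookup within′ m) e))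
      ; nonempty = λ e → a≢b (trans (sym (cong (end a) e)) same-end) }

  out-neighbours-apart : ∀ v a pa b pb → a ≢ b → adj Γ v a ≡ true → adj Γ v b ≡ true → dir v a ≡ true → dir v b ≡ true →
    Walk a pa → Walk b pb → All (Beside v a) (a ∷ pa) → All (Beside v b) (b ∷ pb) →
    (end a pa ≡ end b pb ⊎ adj Γ (end a pa) (end b pb) ≡ true) → ⊥
  out-neighbours-apart v a pa b pb a≢b va vb dva dvb wa wb beside-a beside-b meet with join meet
    where
    Joined : Set
    Joined = Σ (List V) λ ws → Walk a ws × end a ws ≡ b × (∀ {z} → z ∈ a ∷ ws → z ∈ a ∷ pa ⊎ z ∈ b ∷ pb)
    join : (end a pa ≡ end b pb ⊎ adj Γ (end a pa) (end b pb) ≡ true) → Joined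
    join (inj₁ same) =
      pa ++ reverseTail b pb ,
      Walk-++ pa _ wa (subst (λ u → Walk u (reverseTail b pb)) (sym same) (Walk-reversed b pb wb)) ,
      trans (end-++ a pa _) (trans (cong (λ u → end u (reverseTail b pb)) same) (end-reverseTail b pb)) ,
      λ { (here e) → inj₁ (here e)
        ; (there m) → Data.Sum.map there (λ m′ → ∈-reversed⁻ b pb (there m′)) (Any.++⁻ pa m) }
    join (inj₂ adjacent) =
      pa ++ end b pb ∷ reverseTail b pb ,
      Walk-++ pa _ wa (adjacent ∷ʷ Walk-reversed b pb wb) ,
      trans (end-++ a pa _) (end-reverseTail b pb) ,
      λ { (here e) → inj₁ (here e)
        ; (there m) → Data.Sum.map there (∈-reversed⁻ b pb) (Any.++⁻ pa m) }
  ... | ws , w , e , origin = no-walk-between-out-neighbours v a ws (λ q → a≢b (trans q e)) va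
    (subst (λ u → adj Γ v u ≡ true) (sym e) vb) dva (subst (λ u → dir v u ≡ true) (sym e) dvb) w
    (All.tabulate λ m → either (proj₁ ∘ All.lookup beside-a) (proj₁ ∘ All.lookup beside-b) (origin m))
    (All.tabulate λ m q → either (λ m′ → inj₁ (proj₂ (All.lookup beside-a m′) q))
                                 (λ m′ → inj₂ (trans (proj₂ (All.lookup beside-b m′) q) (sym e))) (origin m))

  out-neighbours-nonadjacent : ∀ v a b → adj Γ v a ≡ true → adj Γ v b ≡ true → dir v a ≡ true → dir v b ≡ true →
    adj Γ a b ≡ true → ⊥
  out-neighbours-nonadjacent v a b va vb dva dvb ab = out-neighbours-apart v a [] b [] (adj⇒≢ ab) va vb dva dvb []ʷ []ʷ
    ((adj⇒≢ (trans (adj-sym Γ _ _) va) , λ _ → refl) ∷ []) ((adj⇒≢ (trans (adj-sym Γ _ _) vb) , λ _ → refl) ∷ []) (inj₂ ab)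

  record Prefix (a : V) (as : List V) (x : V) : Set where
    field
      prefix : List V
      walk : Walk a prefix
      reaches : end a prefix ≡ x
      before-end : All (λ z → z ∈ a ∷ as × z ≢ end a as) (a ∷ prefix)

  prefix-to : ∀ a as {x} → Walk a as → Unique (a ∷ as) → x ∈ a ∷ as → x ≢ end a as → Prefix a as x
  prefix-to a as w u (here refl) x≢end = record { prefix = [] ; walk = []ʷ ; reaches = refl ; before-end = (here refl , x≢end) ∷ [] }
  prefix-to a (y ∷ ys) (e ∷ʷ w) u@(_ ∷ u′) (there m) x≢end = record
    { prefix = y ∷ prefix
    ; walk = e ∷ʷ walk
    ; reaches = reaches
    ; before-end = (here refl , λ q → Unique[x∷xs]⇒x∉xs u (subst (_∈ y ∷ ys) (sym q) (end-∈ y ys)))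
                   ∷ All.map (Data.Product.map₁ there) before-end }
    where open Prefix (prefix-to y ys w u′ m x≢end)

  CycleAt-beside : ∀ {v a as} → CycleAt v a as → ∀ {z} → z ∈ a ∷ as → z ≢ end a as → Beside v a z
  CycleAt-beside P m z≢end =
    (λ e → CycleAt.v∉ P (subst (_∈ _) e m)) ,
    (λ q → either id (⊥-elim ∘ z≢end) (All.lookup (CycleAt.adj-only-ends P) m q))

  forward-paths-unique : ∀ x xs ys → Walk x xs → Chordless x xs → Unique (x ∷ xs) → Dir.Walk x xs →
    Walk x ys → Chordless x ys → Unique (x ∷ ys) → Dir.Walk x ys → end x xs ≡ end x ys → xs ≡ ys
  forward-paths-unique x [] [] _ _ _ _ _ _ _ _ _ = refl
  forward-paths-unique x [] (y ∷ ys) _ _ _ _ _ _ u _ e = ⊥-elim (Unique[x∷xs]⇒x∉xs u (subst (_∈ y ∷ ys) (sym e) (end-∈ y ys)))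
  forward-paths-unique x (y ∷ ys) [] _ _ u _ _ _ _ _ e = ⊥-elim (Unique[x∷xs]⇒x∉xs u (subst (_∈ y ∷ ys) e (end-∈ y ys)))
  forward-paths-unique x (p ∷ xs) (q ∷ ys) (xp ∷ʷ wp) (np ∷ᶜ cp) up@(_ ∷ up′) (dp Dir.∷ʷ fp)
                                          (xq ∷ʷ wq) (nq ∷ᶜ cq) uq@(_ ∷ uq′) (dq Dir.∷ʷ fq) e with p Fin.≟ q
  ... | yes refl = cong (p ∷_) (forward-paths-unique p xs ys wp cp up′ fp wq cq uq′ fq e)
  ... | no p≢q = ⊥-elim (out-neighbours-apart x p xs q ys p≢q xp xq dp dq wp wq
                          (beside-head up (np ∷ᶜ cp)) (beside-head uq (nq ∷ᶜ cq)) (inj₁ e))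

  -- The cycle up to z, followed by the edge z u, would join the out-neighbours x and u of v.
  forward-no-outer-neighbour : ∀ {v x xs z u} → CycleAt v x xs → dir v x ≡ true → z ∈ x ∷ xs → z ≢ end x xs →
    adj Γ z u ≡ true → adj Γ v u ≡ true → dir v u ≡ true → u ≢ x → ⊥
  forward-no-outer-neighbour {v} {x} {xs} {z} {u} P dvx m z≢end zu vu dvu u≢x =
    out-neighbours-apart v x prefix u [] (u≢x ∘ sym) (CycleAt.adj-head P) vu dvx dvu walk []ʷ
      (All.map (λ { (m′ , q) → CycleAt-beside P m′ q }) before-end)
      (((λ e → adj⇒≢ vu (sym e)) , (λ _ → refl)) ∷ [])
      (inj₂ (subst (λ w → adj Γ w u ≡ true) (sym reaches) zu))
    where open Prefix (prefix-to x xs (CycleAt.walk P) (CycleAt.unique P) m z≢end)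

reverse-orientation : ∀ {n} {Γ : Graph n} → CyclicallyOrientable Γ → CyclicallyOrientable Γ
reverse-orientation {Γ = Γ} ((dir , anti) , cyclic) =
  ((λ u v → dir v u) , λ u v e → anti v u (trans (adj-sym Γ v u) e)) , λ m C → Data.Sum.swap (cyclic m C)

module BothWays {n : ℕ} (Γ : Graph n) (co : CyclicallyOrientable Γ) where
  open OnGraph Γ
  module Fw = Cyclic Γ co
  module Bw = Cyclic Γ (reverse-orientation co)
  open Fw public using (dir; dir-flip)

  CycleAt-orientation : ∀ {v a as} → CycleAt v a as →
    (dir v a ≡ true × dir (end a as) v ≡ true) ⊎ (dir a v ≡ true × dir v (end a as) ≡ true)
  CycleAt-orientation {v} {a} P with dir v a in dva
  ... | true = inj₁ (refl , Fw.Forward.back (Fw.CycleAt-forward P dva))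
  ... | false = inj₂ (dav , Bw.Forward.back (Bw.CycleAt-forward P dav))
    where
    dav : dir a v ≡ true
    dav = dir-flip (CycleAt.adj-head P) dva

  CycleAt-unique : ∀ {v a as bs} → CycleAt v a as → CycleAt v a bs → end a as ≡ end a bs → as ≡ bs
  CycleAt-unique {v} {a} {as} {bs} P Q e with dir v a in dva
  ... | true = Fw.forward-paths-unique a as bs walk chordless unique (Fw.Forward.path (Fw.CycleAt-forward P dva))
                 Q.walk Q.chordless Q.unique (Fw.Forward.path (Fw.CycleAt-forward Q dva)) e
    where
    open CycleAt P
    module Q = CycleAt Q
  ... | false = Bw.forward-paths-unique a as bs walk chordless unique (Bw.Forward.path (Bw.CycleAt-forward P dav))
                  Q.walk Q.chordless Q.unique (Bw.Forward.path (Bw.CycleAt-forward Q dav)) e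
    where
    open CycleAt P
    module Q = CycleAt Q
    dav : dir a v ≡ true
    dav = dir-flip adj-head dva

  no-outer-neighbour : ∀ {v x xs z u} → CycleAt v x xs → z ∈ x ∷ xs → z ≢ x → z ≢ end x xs →
    adj Γ z u ≡ true → adj Γ v u ≡ true → dir v u ≡ true → u ≢ x → u ≢ end x xs → ⊥
  no-outer-neighbour {x = x} {xs} P m z≢x z≢end zu vu dvu u≢x u≢end with CycleAt-orientation P
  ... | inj₁ (dvx , _) = Fw.forward-no-outer-neighbour P dvx m z≢end zu vu dvu u≢x
  ... | inj₂ (_ , dvend) = Fw.forward-no-outer-neighbour (CycleAt-reversed P) dvend (∈-reversed⁺ x xs m)
                             (λ e → z≢x (trans e (end-reverseTail x xs))) zu vu dvu u≢end

-- The link graph at a vertex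

module LinkForest {n : ℕ} (Γ : Graph n) (co : CyclicallyOrientable Γ) (v : Fin n) (H : Graph n) where
  open OnGraph Γ
  open BothWays Γ co
  module H = OnGraph H

  module _ (link : ∀ x y → adj H x y ≡ true → Link v x y)
           (neighbours-linked : ∀ x y → adj Γ x y ≡ true → adj Γ v x ≡ true → adj Γ v y ≡ true → adj H x y ≡ true) where

    -- Read backwards, both paths leave v forwards, towards different vertices, and meet at z.
    disjoint-interiors : ∀ c → dir v c ≡ true → ∀ {Fs Gs z} → CycleAt v c Fs → CycleAt v c Gs → end c Fs ≢ end c Gs →
      z ∈ Fs → z ∈ Gs → ⊥
    disjoint-interiors c dvc {Fs} {Gs} {z} P Q ends-differ zF zG =
      Bw.out-neighbours-apart v (end c Fs) F.prefix (end c Gs) G.prefix ends-differ (CycleAt.adj-end P) (CycleAt.adj-end Q)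
        (Fw.Forward.back (Fw.CycleAt-forward P dvc)) (Fw.Forward.back (Fw.CycleAt-forward Q dvc))
        F.walk G.walk
        (All.map (λ { (m , q) → Bw.CycleAt-beside (CycleAt-reversed P) m q }) F.before-end)
        (All.map (λ { (m , q) → Bw.CycleAt-beside (CycleAt-reversed Q) m q }) G.before-end)
        (inj₁ (trans F.reaches (sym G.reaches)))
      where
      z≢c : ∀ {xs} → CycleAt v c xs → z ∈ xs → z ≢ end (end c xs) (reverseTail c xs)
      z≢c {xs} P m e = Unique[x∷xs]⇒x∉xs (CycleAt.unique P) (subst (_∈ xs) (trans e (end-reverseTail c xs)) m)
      prefix-in : ∀ {xs} → CycleAt v c xs → z ∈ xs → Bw.Prefix (end c xs) (reverseTail c xs) z
      prefix-in {xs} P m = Bw.prefix-to (end c xs) (reverseTail c xs) (CycleAt.walk (CycleAt-reversed P))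
        (CycleAt.unique (CycleAt-reversed P)) (∈-reversed⁺ c xs (there m)) (z≢c P m)
      module F = Bw.Prefix (prefix-in P zF)
      module G = Bw.Prefix (prefix-in Q zG)

    -- Given an H-cycle c, a, …, l whose edges c a and c l are realised by PF and PG, the walk
    -- f, …, a ⇝ … ⇝ l, …, g joins two out-neighbours f ≠ g of c while avoiding the rest of c's neighbourhood.
    module Absurd {c a as f fs g gs} (dvc : dir v c ≡ true) (Ph : H.CycleAt c a as)
        (PF : CycleAt v c (f ∷ fs)) (eF : end f fs ≡ a) (PG : CycleAt v c (g ∷ gs)) (eG : end g gs ≡ end a as) where

      module Ph = H.CycleAt Ph

      vc : adj Γ v c ≡ true
      vc = CycleAt.adj-head PF

      first : ∀ {x xs} → CycleAt v c (x ∷ xs) → adj Γ c x ≡ true × dir c x ≡ true × Walk x xs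
      first P with CycleAt.walk P | Fw.Forward.path (Fw.CycleAt-forward P dvc)
      ... | cx ∷ʷ w | dcx Fw.Dir.∷ʷ _ = cx , dcx , w

      va : adj Γ v a ≡ true
      va = subst (λ u → adj Γ v u ≡ true) eF (CycleAt.adj-end PF)

      vl : adj Γ v (end a as) ≡ true
      vl = subst (λ u → adj Γ v u ≡ true) eG (CycleAt.adj-end PG)

      a≢l : a ≢ end a as
      a≢l = head≢end a as Ph.unique Ph.nonempty

      c∉ : ∀ {q} → q ∈ a ∷ as → q ≢ c
      c∉ m e = Ph.v∉ (subst (_∈ a ∷ as) e m)

      Good : V → Set
      Good z = z ≢ c × (adj Γ c z ≡ true → z ≡ f ⊎ z ≡ g)

      good-on-H-path : ∀ {q} → q ∈ a ∷ as → adj Γ v q ≡ true → Good q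
      good-on-H-path {q} m vq = c∉ m , λ cq → on-ends cq (All.lookup Ph.adj-only-ends m (neighbours-linked c q cq vc vq))
        where
        on-ends : adj Γ c q ≡ true → q ≡ a ⊎ q ≡ end a as → q ≡ f ⊎ q ≡ g
        on-ends cq (inj₁ refl) = inj₁ (trans (sym eF) (cong (end f)
          (adj-end⇒single-edge (CycleAt.chordless PF) (subst (λ u → adj Γ c u ≡ true) (sym eF) cq))))
        on-ends cq (inj₂ refl) = inj₂ (trans (sym eG) (cong (end g)
          (adj-end⇒single-edge (CycleAt.chordless PG) (subst (λ u → adj Γ c u ≡ true) (sym eG) cq))))

      good-on-link : ∀ {x xs} → CycleAt v x xs → x ∈ a ∷ as → end x xs ∈ a ∷ as → All Good (x ∷ xs)
      good-on-link {x} {xs} P mx ml = All.tabulate good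
        where
        good : ∀ {z} → z ∈ x ∷ xs → Good z
        good {z} m with z Fin.≟ x | z Fin.≟ end x xs
        ... | yes refl | _ = good-on-H-path mx (CycleAt.adj-head P)
        ... | no _ | yes refl = good-on-H-path ml (CycleAt.adj-end P)
        ... | no z≢x | no z≢end =
          (λ z≡c → either z≢x z≢end (All.lookup (CycleAt.adj-only-ends P) m (subst (λ u → adj Γ v u ≡ true) (sym z≡c) vc))) ,
          (λ cz → ⊥-elim (no-outer-neighbour P m z≢x z≢end (trans (adj-sym Γ z c) cz) vc dvc (c∉ mx ∘ sym) (c∉ ml ∘ sym)))

      realise-H-path : ∀ x xs → All (_∈ a ∷ as) (x ∷ xs) → adj Γ v x ≡ true → H.Walk x xs →
        Σ (List V) λ S → Walk x S × end x S ≡ end x xs × All Good (x ∷ S)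
      realise-H-path x [] (mx ∷ []) vx H.[]ʷ = [] , []ʷ , refl , good-on-H-path mx vx ∷ []
      realise-H-path x (y ∷ ys) (mx ∷ my ∷ ms) vx (hxy H.∷ʷ w) with link x y hxy
      ... | L , PL , eL with realise-H-path y ys (my ∷ ms) (subst (λ u → adj Γ v u ≡ true) eL (CycleAt.adj-end PL)) w
      ...   | S , wS , endS , goodS =
        L ++ S , Walk-++ L S (CycleAt.walk PL) (subst (λ u → Walk u S) (sym eL) wS) ,
        trans (end-++ x L S) (trans (cong (λ u → end u S) eL) endS) ,
        All.++⁺ (good-on-link PL mx (subst (_∈ a ∷ as) (sym eL) my)) (All.tail goodS)

      f≢g : f ≢ g
      f≢g = distinct-heads fs gs PF eF PG eG
        where
        distinct-heads : ∀ fs gs → CycleAt v c (f ∷ fs) → end f fs ≡ a → CycleAt v c (g ∷ gs) → end g gs ≡ end a as → f ≢ g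
        distinct-heads [] gs P eP Q eQ f≡g = either (c∉ (here refl)) (λ q → a≢l (trans q eQ))
          (All.lookup (CycleAt.adj-only-ends Q) (there (here (trans (sym eP) f≡g))) va)
        distinct-heads (y ∷ ys) [] P eP Q eQ f≡g = either (c∉ (end-∈ a as)) (λ q → a≢l (sym (trans q eP)))
          (All.lookup (CycleAt.adj-only-ends P) (there (here (trans (sym eQ) (sym f≡g)))) vl)
        distinct-heads (y ∷ ys) (z ∷ zs) P eP Q eQ f≡g =
          disjoint-interiors c dvc P Q (λ q → a≢l (trans (sym eP) (trans q eQ))) (here refl) (here f≡g)

      absurd : ⊥
      absurd with realise-H-path a as (All.tabulate id) va Ph.walk | first PF | first PG
      ... | S , wS , endS , goodS | cf , dcf , wf | cg , dcg , wg =
        Fw.no-walk-between-out-neighbours c f ws (λ q → f≢g (trans q end-ws)) cf (subst (λ u → adj Γ c u ≡ true) (sym end-ws) cg)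
          dcf (subst (λ u → dir c u ≡ true) (sym end-ws) dcg) walk-ws (All.map proj₁ good-ws)
          (All.map (λ { (_ , q) e → Data.Sum.map₂ (λ r → trans r (sym end-ws)) (q e) }) good-ws)
        where
        back : List V
        back = reverseTail g gs
        ws : List V
        ws = fs ++ (S ++ back)
        S-meets-G : end a S ≡ end g gs
        S-meets-G = trans endS (sym eG)
        walk-ws : Walk f ws
        walk-ws = Walk-++ fs (S ++ back) wf (subst (λ u → Walk u (S ++ back)) (sym eF)
                    (Walk-++ S back wS (subst (λ u → Walk u back) (sym S-meets-G) (Walk-reversed g gs wg))))
        end-ws : end f ws ≡ g
        end-ws = begin
          end f (fs ++ S ++ back)        ≡⟨ end-++ f fs (S ++ back) ⟩
          end (end f fs) (S ++ back)     ≡⟨ cong (λ u → end u (S ++ back)) eF ⟩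
          end a (S ++ back)              ≡⟨ end-++ a S back ⟩
          end (end a S) back             ≡⟨ cong (λ u → end u back) S-meets-G ⟩
          end (end g gs) back            ≡⟨ end-reverseTail g gs ⟩
          g                              ∎
          where open ≡-Reasoning
        good-F : All Good (f ∷ fs)
        good-F = All.map (Data.Product.map₂ (inj₁ ∘_)) (beside-head (CycleAt.unique PF) (CycleAt.chordless PF))
        good-G : All Good back
        good-G = All.tabulate λ m → Data.Product.map₂ (inj₂ ∘_)
          (All.lookup (beside-head (CycleAt.unique PG) (CycleAt.chordless PG)) (∈-reversed⁻ g gs (there m)))
        good-ws : All Good (f ∷ ws)
        good-ws = All.++⁺ good-F (All.++⁺ (All.tail goodS) good-G)

    no-H-cycle : ∀ {c a as} → dir v c ≡ true → H.CycleAt c a as → ⊥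
    no-H-cycle {c} {a} {as} dvc Ph with link c a (H.CycleAt.adj-head Ph) | link c (end a as) (H.CycleAt.adj-end Ph)
    ... | [] , PF , _ | _ = CycleAt.nonempty PF refl
    ... | _ ∷ _ , _ , _ | [] , PG , _ = CycleAt.nonempty PG refl
    ... | f ∷ fs , PF , eF | g ∷ gs , PG , eG = Absurd.absurd dvc Ph PF eF PG eG

all-lists : ∀ {A : Set} → List A → ℕ → List (List A)
all-lists xs zero = [ [] ]
all-lists xs (suc k) = [] ∷ cartesianProductWith _∷_ xs (all-lists xs k)

∈-all-lists : ∀ {N} k (ys : List (Fin N)) → length ys ≤ k → ys ∈ all-lists (allFin N) k
∈-all-lists zero [] _ = here refl
∈-all-lists (suc k) [] _ = here refl
∈-all-lists (suc k) (y ∷ ys) (s≤s le) = there (∈-cartesianProductWith⁺ _∷_ (∈-allFin y) (∈-all-lists k ys le))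

module _ {n : ℕ} (Γ : Graph n) where
  open OnGraph Γ

  CycleAt? : ∀ v a as → Dec (CycleAt v a as)
  CycleAt? v a as = map′
    (λ (w , c , u , v∉ , ha , he , only , ne) → record
       { walk = w ; chordless = c ; unique = u ; v∉ = v∉ ; adj-head = ha ; adj-end = he ; adj-only-ends = only ; nonempty = ne })
    (λ P → let open CycleAt P in walk , chordless , unique , v∉ , adj-head , adj-end , adj-only-ends , nonempty)
    (walk? a as ×-dec chordless? a as ×-dec UniqueDec.unique? Fin._≟_ (a ∷ as) ×-dec ¬? (DecMembership._∈?_ Fin._≟_ v (a ∷ as))
      ×-dec adj Γ v a Bool.≟ true ×-dec adj Γ v (end a as) Bool.≟ true
      ×-dec All.all? (onlyEnds? v a (end a as)) (a ∷ as) ×-dec nonempty? as)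
    where
    nonempty? : (as : List V) → Dec (as ≢ [])
    nonempty? [] = no (λ ne → ne refl)
    nonempty? (_ ∷ _) = yes (λ ())

restrict : ∀ {n} → Graph (suc n) → Graph n
restrict Γ = record { adj = λ i j → adj Γ (suc i) (suc j) ; sym = λ i j → adj-sym Γ (suc i) (suc j) ; irref = λ i → irref Γ (suc i) }

liftCycle : ∀ {n} {Γ : Graph (suc n)} {m} → ChordlessCycle (restrict Γ) m → ChordlessCycle Γ m
liftCycle C = record { c = suc ∘ c C ; inj = inj C ∘ Fin.suc-injective ; edges = edges C ; chords = chords C }

restrict-orientable : ∀ {n} (Γ : Graph (suc n)) → CyclicallyOrientable Γ → CyclicallyOrientable (restrict Γ)
restrict-orientable Γ ((dir , anti) , cyclic) =
  ((λ i j → dir (suc i) (suc j)) , (λ u v → anti (suc u) (suc v))) , (λ m → cyclic m ∘ liftCycle)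

lowerCycle : ∀ {n} {Γ : Graph (suc n)} {m} (D : ChordlessCycle Γ m) → (∀ i → c D i ≢ zero) →
  Σ (ChordlessCycle (restrict Γ) m) λ D′ → ∀ i → c D i ≡ suc (c D′ i)
lowerCycle {n} {Γ} {m} D avoids-0 = D′ , lower-suc
  where
  lower : Fin (3 + m) → Fin n
  lower i with c D i | avoids-0 i
  ... | zero | ≢0 = ⊥-elim (≢0 refl)
  ... | suc j | _ = j
  lower-suc : ∀ i → c D i ≡ suc (lower i)
  lower-suc i with c D i | avoids-0 i
  ... | zero | ≢0 = ⊥-elim (≢0 refl)
  ... | suc j | _ = refl
  D′ : ChordlessCycle (restrict Γ) m
  D′ = record
    { c = lower
    ; inj = λ e → inj D (trans (lower-suc _) (trans (cong suc e) (sym (lower-suc _))))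
    ; edges = λ i j p → subst₂ (λ x y → adj Γ x y ≡ true) (lower-suc i) (lower-suc j) (edges D i j p)
    ; chords = λ i j e → chords D i j (subst₂ (λ x y → adj Γ x y ≡ true) (sym (lower-suc i)) (sym (lower-suc j)) e) }

-- Extending a signing across vertex 0

module Extension {n : ℕ} (Γ : Graph (suc n)) (co : CyclicallyOrientable Γ)
  (s′ : Fin n → Fin n → Sign) (s′-sym : ∀ u v → adj (restrict Γ) u v ≡ true → s′ u v ≡ s′ v u)
  (s′-negative : AllChordlessNegative (restrict Γ) s′) where

  open OnGraph Γ
  open BothWays Γ co

  extend : (V → Sign) → V → V → Sign
  extend σ zero zero = pos
  extend σ zero (suc j) = σ (suc j)
  extend σ (suc i) zero = σ (suc i)
  extend σ (suc i) (suc j) = s′ i j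

  extend-sym : ∀ σ u v → adj Γ u v ≡ true → extend σ u v ≡ extend σ v u
  extend-sym σ zero zero _ = refl
  extend-sym σ zero (suc j) _ = refl
  extend-sym σ (suc i) zero _ = refl
  extend-sym σ (suc i) (suc j) e = s′-sym i j e

  walkSign-extend : ∀ σ τ x xs → zero ∉ x ∷ xs → walkSign (extend σ) x xs ≡ walkSign (extend τ) x xs
  walkSign-extend σ τ x [] _ = refl
  walkSign-extend σ τ zero (y ∷ ys) 0∉ = ⊥-elim (0∉ (here refl))
  walkSign-extend σ τ (suc i) (zero ∷ ys) 0∉ = ⊥-elim (0∉ (there (here refl)))
  walkSign-extend σ τ (suc i) (suc j ∷ ys) 0∉ = cong (s′ i j ·_) (walkSign-extend σ τ (suc j) ys (0∉ ∘ there))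

  s₀ : V → V → Sign
  s₀ = extend (λ _ → pos)

  -- Searching lists of length at most n is exhaustive: a path avoiding 0 has no repeated vertex.
  OutLink : V → V → Set
  OutLink x y = dir zero x ≡ true × Any (λ xs → CycleAt zero x xs × end x xs ≡ y) (all-lists (allFin (suc n)) n)

  -- Opaque, so that `with out-link? x y` also abstracts the occurrences hidden in H-adj x y.
  opaque
    out-link? : ∀ x y → Dec (OutLink x y)
    out-link? x y = dir zero x Bool.≟ true ×-dec Any.any? (λ xs → CycleAt? Γ zero x xs ×-dec end x xs Fin.≟ y) _

  out-link : ∀ {x xs} → dir zero x ≡ true → CycleAt zero x xs → length xs ≤ n → OutLink x (end x xs)
  out-link {xs = xs} d P le = d , Any.map (λ { refl → P , refl }) (∈-all-lists n xs le)

  OutLink⇒Link : ∀ {x y} → OutLink x y → Link zero x y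
  OutLink⇒Link (_ , found) = Any.satisfied found

  linkSign : ∀ {x y} → OutLink x y → Sign
  linkSign {x} l = neg · walkSign s₀ x (proj₁ (OutLink⇒Link l))

  linkSign-path : ∀ {x y xs} (l : OutLink x y) → CycleAt zero x xs → end x xs ≡ y → linkSign l ≡ neg · walkSign s₀ x xs
  linkSign-path {x} l P e with OutLink⇒Link l
  ... | ys , Q , e′ = cong (λ zs → neg · walkSign s₀ x zs) (CycleAt-unique Q P (trans e′ (sym e)))

  out-link-asym : ∀ {x y} → OutLink x y → OutLink y x → ⊥
  out-link-asym l@(d0x , _) (d0y , _) with OutLink⇒Link l
  ... | xs , P , refl = Fw.dir-asym (CycleAt.adj-end P) d0y (Fw.Forward.back (Fw.CycleAt-forward P d0x))

  no-out-loop : ∀ {x} → OutLink x x → ⊥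
  no-out-loop l with OutLink⇒Link l
  ... | xs , P , e = head≢end _ xs (CycleAt.unique P) (CycleAt.nonempty P) (sym e)

  H-adj : V → V → Bool
  H-adj x y = does (out-link? x y) ∨ does (out-link? y x)

  H : Graph (suc n)
  H = record { adj = H-adj ; sym = λ x y → Bool.∨-comm (does (out-link? x y)) _ ; irref = H-irrefl }
    where
    H-irrefl : ∀ x → does (out-link? x x) ∨ does (out-link? x x) ≡ false
    H-irrefl x with out-link? x x
    ... | yes l = ⊥-elim (no-out-loop l)
    ... | no _ = refl

  H-sign : V → V → Sign
  H-sign x y with out-link? x y | out-link? y x
  ... | yes l | _ = linkSign l
  ... | no _ | yes l = linkSign l
  ... | no _ | no _ = pos

  H-sign-sym : ∀ x y → does (out-link? x y) ∨ does (out-link? y x) ≡ true → H-sign x y ≡ H-sign y x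
  H-sign-sym x y e with out-link? x y | out-link? y x
  ... | yes l | yes l′ = ⊥-elim (out-link-asym l l′)
  ... | yes _ | no _ = refl
  ... | no _ | yes _ = refl
  ... | no _ | no _ = ⊥-elim (true≢false (sym e))

  H-sign-link : ∀ {x y xs} → OutLink x y → CycleAt zero x xs → end x xs ≡ y → H-sign x y ≡ neg · walkSign s₀ x xs
  H-sign-link {x} {y} l P e with out-link? x y
  ... | yes l′ = linkSign-path l′ P e
  ... | no ¬l = ⊥-elim (¬l l)

  H-edge⇒Link : ∀ x y → does (out-link? x y) ∨ does (out-link? y x) ≡ true → Link zero x y
  H-edge⇒Link x y e with out-link? x y | out-link? y x
  ... | yes l | _ = OutLink⇒Link l
  ... | no _ | yes l with OutLink⇒Link l
  ...   | xs , P , refl = reverseTail y xs , CycleAt-reversed P , end-reverseTail y xs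
  H-edge⇒Link x y e | no _ | no _ = ⊥-elim (true≢false (sym e))

  triangle : ∀ {x y} → adj Γ x y ≡ true → adj Γ zero x ≡ true → adj Γ zero y ≡ true → CycleAt zero x [ y ]
  triangle xy 0x 0y = record
    { walk = xy ∷ʷ []ʷ
    ; chordless = [] ∷ᶜ []ᶜ
    ; unique = ((λ e → adj⇒≢ xy e) ∷ []) ∷ [] ∷ []
    ; v∉ = λ { (here e) → adj⇒≢ 0x e ; (there (here e)) → adj⇒≢ 0y e }
    ; adj-head = 0x
    ; adj-end = 0y
    ; adj-only-ends = (λ _ → inj₁ refl) ∷ (λ _ → inj₂ refl) ∷ []
    ; nonempty = λ () }

  one≤n : ∀ {y} → adj Γ zero y ≡ true → 1 ≤ n
  one≤n {zero} e = ⊥-elim (adj⇒≢ e refl)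
  one≤n {suc j} _ = ℕ.≤-trans (s≤s z≤n) (Fin.toℕ<n j)

  neighbours-linked : ∀ x y → adj Γ x y ≡ true → adj Γ zero x ≡ true → adj Γ zero y ≡ true → H-adj x y ≡ true
  neighbours-linked x y xy 0x 0y with dir zero x in d0x | dir zero y in d0y
  ... | true | true = ⊥-elim (Fw.out-neighbours-nonadjacent zero x y 0x 0y d0x d0y xy)
  ... | false | false = ⊥-elim (Bw.out-neighbours-nonadjacent zero x y 0x 0y (dir-flip 0x d0x) (dir-flip 0y d0y) xy)
  ... | true | false = cong (_∨ does (out-link? y x)) (dec-true (out-link? x y) (out-link d0x (triangle xy 0x 0y) (one≤n 0y)))
  ... | false | true = trans (cong (does (out-link? x y) ∨_)
                               (dec-true (out-link? y x) (out-link d0y (triangle (trans (adj-sym Γ y x) xy) 0y 0x) (one≤n 0x))))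
                             (Bool.∨-zeroʳ _)

  H-acyclic : ∀ {c a as} → OnGraph.CycleAt H c a as → ⊥
  H-acyclic {c} P with dir zero c in d0c
  ... | true = LinkForest.no-H-cycle Γ co zero H H-edge⇒Link neighbours-linked d0c P
  ... | false = LinkForest.no-H-cycle Γ (reverse-orientation co) zero H H-edge⇒Link neighbours-linked
                  (dir-flip (CycleAt.adj-head (proj₁ (proj₂ (H-edge⇒Link c _ (OnGraph.CycleAt.adj-head P))))) d0c) P

  potential : HasPotential H-adj H-sign
  potential = balanced⇒potential (suc n) H-adj H-sign (adj-sym H) H-sign-sym
    (chordless-positive⇒balanced H H-sign H-sign-sym (⊥-elim ∘ H-acyclic))

  σ : V → Sign
  σ = proj₁ potential

  s : V → V → Sign
  s = extend σ

  ends-sign : ∀ {A As} → CycleAt zero A As → length As ≤ n → σ A · σ (end A As) ≡ neg · walkSign s₀ A As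
  ends-sign {A} {As} P le with CycleAt-orientation P
  ... | inj₁ (d0A , _) = begin
    σ A · σ (end A As)          ≡⟨ proj₂ potential A (end A As) H-edge ⟨
    H-sign A (end A As)         ≡⟨ H-sign-link l P refl ⟩
    neg · walkSign s₀ A As      ∎
    where
    open ≡-Reasoning
    l : OutLink A (end A As)
    l = out-link d0A P le
    H-edge : H-adj A (end A As) ≡ true
    H-edge = cong (_∨ does (out-link? (end A As) A)) (dec-true (out-link? A (end A As)) l)
  ... | inj₂ (_ , d0L) = begin
    σ A · σ L                               ≡⟨ *-comm (σ A) (σ L) ⟩
    σ L · σ A                               ≡⟨ proj₂ potential L A H-edge ⟨
    H-sign L A                              ≡⟨ H-sign-link l P′ (end-reverseTail A As) ⟩
    neg · walkSign s₀ L (reverseTail A As)  ≡⟨ cong (neg ·_) (walkSign-reversed s₀ (extend-sym _) A As (CycleAt.walk P)) ⟨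
    neg · walkSign s₀ A As                  ∎
    where
    open ≡-Reasoning
    L : V
    L = end A As
    P′ : CycleAt zero L (reverseTail A As)
    P′ = CycleAt-reversed P
    l : OutLink L A
    l = subst (OutLink L) (end-reverseTail A As) (out-link d0L P′ (subst (_≤ n) (sym (length-reverseTail A As)) le))
    H-edge : H-adj L A ≡ true
    H-edge = cong (_∨ does (out-link? A L)) (dec-true (out-link? L A) l)

  s-sym : ∀ u v → adj Γ u v ≡ true → s u v ≡ s v u
  s-sym = extend-sym σ

  extend-at-0 : ∀ {A} → A ≢ zero → s zero A ≡ σ A × s A zero ≡ σ A
  extend-at-0 {zero} A≢0 = ⊥-elim (A≢0 refl)
  extend-at-0 {suc _} _ = refl , refl

  through-0-negative : ∀ {A As} → CycleAt zero A As → length As ≤ n → walkSign s zero (A ∷ As ++ [ zero ]) ≡ neg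
  through-0-negative {A} {As} P le = begin
    s zero A · walkSign s A (As ++ [ zero ])        ≡⟨ cong (s zero A ·_) (walkSign-++ s A As [ zero ]) ⟩
    s zero A · (walkSign s A As · (s L zero · pos)) ≡⟨ cong₃ (λ a w l → a · (w · (l · pos)))
                                                         (proj₁ (extend-at-0 A≢0)) (walkSign-extend σ _ A As (CycleAt.v∉ P)) (proj₂ (extend-at-0 L≢0)) ⟩
    σ A · (W · (σ L · pos))                         ≡⟨ solve 3 (λ a w l → a ⊕ (w ⊕ (l ⊕ ε)) ⊜ (a ⊕ l) ⊕ w) refl (σ A) W (σ L) ⟩
    σ A · σ L · W                                   ≡⟨ cong (_· W) (ends-sign P le) ⟩
    neg · W · W                                     ≡⟨ *-assoc neg W W ⟩
    neg · (W · W)                                   ≡⟨ cong (neg ·_) (s*s≡+ W) ⟩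
    neg                                             ∎
    where
    open ≡-Reasoning
    L : V
    L = end A As
    W : Sign
    W = walkSign s₀ A As
    A≢0 : A ≢ zero
    A≢0 e = CycleAt.v∉ P (here (sym e))
    L≢0 : L ≢ zero
    L≢0 e = CycleAt.v∉ P (subst (_∈ A ∷ As) e (end-∈ A As))
    cong₃ : ∀ {a a′ b b′ c c′ : Sign} (f : Sign → Sign → Sign → Sign) → a ≡ a′ → b ≡ b′ → c ≡ c′ → f a b c ≡ f a′ b′ c′
    cong₃ f refl refl refl = refl

  all-negative : AllChordlessNegative Γ s
  all-negative m D with Fin.any? (λ i → c D i Fin.≟ zero)
  ... | no avoids-0 = begin
    cycleProduct s D                                   ≡⟨ cycleProduct-tabulate s D ⟩
    ∏ (tabulate (λ i → s (c D i) (c D (next i))))     ≡⟨ cong ∏ (List.tabulate-cong (λ i → cong₂ s (lower-suc i) (lower-suc (next i)))) ⟩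
    ∏ (tabulate (λ i → s′ (c D′ i) (c D′ (next i))))  ≡⟨ OnGraph.cycleProduct-tabulate (restrict Γ) s′ D′ ⟨
    cycleProduct s′ D′                                 ≡⟨ s′-negative m D′ ⟩
    neg                                                ∎
    where
    open ≡-Reasoning
    lowered = lowerCycle D (λ i e → avoids-0 (i , e))
    D′ : ChordlessCycle (restrict Γ) m
    D′ = proj₁ lowered
    lower-suc : ∀ i → c D i ≡ suc (c D′ i)
    lower-suc = proj₂ lowered
  ... | yes (p , Dp≡0) = begin
    cycleProduct s D                                                      ≡⟨ cycleProduct-rotateCycle s D (toℕ p) ⟨
    cycleProduct s D^                                                     ≡⟨ cycleProduct-walkSign s D^ ⟩
    walkSign s (c D^ zero) (tabulate (c D^ ∘ suc) ++ [ c D^ zero ])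
      ≡⟨ cong (λ v → walkSign s v (tabulate (c D^ ∘ suc) ++ [ v ])) starts-at-0 ⟩
    walkSign s zero (tabulate (c D^ ∘ suc) ++ [ zero ])
      ≡⟨ through-0-negative (subst (λ v → CycleAt v (c D^ (suc zero)) rest) starts-at-0 (fromCycle D^)) short ⟩
    neg                                                                   ∎
    where
    open ≡-Reasoning
    D^ : ChordlessCycle Γ m
    D^ = rotateCycle D (toℕ p)
    starts-at-0 : c D^ zero ≡ zero
    starts-at-0 = trans (cong (c D) (rotate-toℕ-zero p)) Dp≡0
    rest : List V
    rest = tabulate (λ i → c D^ (suc (suc i)))
    short : length rest ≤ n
    short = subst (_≤ n) (sym (List.length-tabulate (λ i → c D^ (suc (suc i)))))
      (ℕ.≤-trans (ℕ.n≤1+n (suc m)) (ℕ.≤-pred (Fin.injective⇒≤ (inj D))))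

existence : ∀ n (Γ : Graph n) → CyclicallyOrientable Γ → Σ (Signing Γ) (λ s → AllChordlessNegative Γ (proj₁ s))
existence zero Γ co = ((λ _ _ → pos) , (λ _ _ _ → refl)) , (λ m C → case c C zero of λ ())
existence (suc n) Γ co with existence n (restrict Γ) (restrict-orientable Γ co)
... | (s′ , s′-sym) , s′-negative = (s , s-sym) , all-negative
  where open Extension Γ co s′ s′-sym s′-negative

corollary5p2 : ∀ (n : ℕ) (Γ : Graph n) → CyclicallyOrientable Γ →
    Σ (Signing Γ) (λ s → AllChordlessNegative Γ (proj₁ s)) ×
    (∀ (s t : Signing Γ) → AllChordlessNegative Γ (proj₁ s) → AllChordlessNegative Γ (proj₁ t) →
    SwitchingEquivalent Γ (proj₁ s) (proj₁ t))
corollary5p2 n Γ co = existence n Γ co , uniqueness Γ
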